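{- Let $k \ge 1$. For any sequences of non-negative integers $\{ n_i\}_{i=1}^{k}$ and $\{ m_j \}_{j=1}^{k}$, and for any integer $a$ satisfying \[ a \ge \max \Big\{ \sum_{j=1}^{i} n_j + \sum_{j=i}^{k} m_j \;\Big|\; 1 \le i \le k \Big\}, \] we have \[ f_{k,q}\big(a;\, n_1,\ldots , n_k;\, m_1,\ldots,m_k\big)=q^{\sum\limits_{1\leq i\leq j\leq k}n_i m_j}\cdot \frac{\prod\limits_{i=0}^{k}\left(q;q\right)_{a-\sum\limits_{j=1}^{k-i}n_j-\sum\limits_{j=k-i+1}^{k}m_j}}{\prod\limits_{i=1}^{k}\left(q;q\right)_{a-\sum\limits_{j=1}^{k-i+1}n_j-\sum\limits_{j=k-i+1}^{k}m_j}}. \]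
   Context: Let $\mathbb{F}$ be a finite field of size $q$. The $q$-Pochhammer symbol is $(a;q)_n = \prod_{i=0}^{n-1}(1-aq^i)$. For a positive integer $k$, sequences of non-negative integers $\{n_i\}_{i=1}^k$, $\{m_j\}_{j=1}^k$, and an integer $a$ with $a \ge \max \{ \sum_{j=1}^{i} n_j + \sum_{j=i}^{k} m_j \mid 1 \le i \le k \}$, define \[ f_{k,q}\big(a;\, n_1,\ldots , n_k;\, m_1,\ldots,m_k\big)=\sum_A \left(q;q\right)_{a-\mathrm{rk}A}, \] where the sum is over all matrices $A\in M_{\sum_{i=1}^k n_i \times\sum_{j=1}^k m_j}(\mathbb{F})$ of the block upper-triangular form \[ A=\begin{pmatrix} Y_{1,1} & Y_{1,2}&\cdots&Y_{1,k} \\ 0&Y_{2,2}&\cdots&Y_{2,k}\\ \vdots&\vdots&&\vdots\\ 0 & 0&\cdots &Y_{k,k} \end{pmatrix}, \] with $Y_{i,j}\in M_{n_i\times m_j}(\mathbb{F})$ arbitrary for all $1\leq i\leq j\leq k$ (empty matrices have rank $0$). -}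

module Defs where

open import Level using (Level; _⊔_) renaming (suc to lsuc)
open import Data.Bool using (Bool; true; false; if_then_else_; _∧_; _∨_; not)
open import Data.Nat as ℕ using (ℕ; zero; suc; _∸_; _<?_; _≤?_)
open import Data.Fin using (Fin; fromℕ<)
import Data.Fin as Fin
open import Data.List using (List; []; _∷_; [_]; map; concatMap; foldr; length; upTo; filter; zipWith)
open import Data.List.Relation.Unary.Any using (Any)
open import Data.List.Relation.Unary.AllPairs using (AllPairs)
open import Data.Integer as ℤ using (ℤ; +_)
open import Data.Product using (∃)
open import Algebra.Bundles using (CommutativeRing)
open import Relation.Nullary using (¬_; Dec; yes; no)
open import Relation.Nullary.Decidable using (⌊_⌋)
open import Relation.Binary.Definitions using (Decidable)

record FiniteField (c ℓ : Level) : Set (lsuc (c ⊔ ℓ)) where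
  field
    commRing : CommutativeRing c ℓ
  open CommutativeRing commRing public
  field
    0≉1      : ¬ (0# ≈ 1#)
    inverse  : ∀ x → ¬ (x ≈ 0#) → ∃ λ y → (x * y) ≈ 1#
    _≟_      : Decidable _≈_
    elements : List Carrier
    complete : ∀ x → Any (x ≈_) elements
    distinct : AllPairs (λ x y → ¬ (x ≈ y)) elements

  size : ℕ
  size = length elements

allFuns : ∀ {a} {A : Set a} → List A → (r : ℕ) → List (Fin r → A)
allFuns xs zero    = [ (λ ()) ]
allFuns xs (suc r) =
  concatMap (λ x → map (λ f → λ { Fin.zero → x ; (Fin.suc i) → f i }) (allFuns xs r)) xs

allLists : ∀ {a} {A : Set a} → List A → ℕ → List (List A)
allLists xs zero    = [ [] ]
allLists xs (suc r) = concatMap (λ x → map (x ∷_) (allLists xs r)) xs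

allFin : (r : ℕ) → List (Fin r)
allFin zero    = []
allFin (suc r) = Fin.zero ∷ map Fin.suc (allFin r)

allB : ∀ {a} {A : Set a} → (A → Bool) → List A → Bool
allB p = foldr (λ x b → p x ∧ b) true

maximum : List ℕ → ℕ
maximum = foldr ℕ._⊔_ 0

-- 1-indexed access to a length-k sequence (0 outside 1..k)
at : ∀ {k} → (Fin k → ℕ) → ℕ → ℕ
at f zero = 0
at {k} f (suc j) with j <? k
... | yes p = f (fromℕ< p)
... | no _  = 0

-- the list [lo, lo+1, ..., hi]  (empty if hi < lo)
range : ℕ → ℕ → List ℕ
range lo hi = map (lo ℕ.+_) (upTo (suc hi ∸ lo))

sumFT : ℕ → ℕ → (ℕ → ℕ) → ℕ
sumFT lo hi g = foldr ℕ._+_ 0 (map g (range lo hi))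

prodℤ : List ℤ → ℤ
prodℤ = foldr ℤ._*_ (+ 1)

poch : ℤ → ℤ → ℕ → ℤ
poch a q n = prodℤ (map (λ i → (+ 1) ℤ.- (a ℤ.* (q ℤ.^ i))) (upTo n))

-- Block structure: for a length-k sequence of block sizes s, the
-- (1-indexed) block containing the 0-indexed position r is
-- 1 + #{ i ∈ 1..k | s_1 + ... + s_i ≤ r }.

blockOf : ∀ {k} → (Fin k → ℕ) → ℕ → ℕ
blockOf {k} s r =
  suc (foldr ℕ._+_ 0 (map (λ i → if ⌊ sumFT 1 i (at s) ≤? r ⌋ then 1 else 0) (range 1 k)))

module FF {c ℓ} (F : FiniteField c ℓ) where
  open FiniteField F

  Matrix : ℕ → ℕ → Set c
  Matrix r s = Fin r → Fin s → Carrier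

  isZero : Carrier → Bool
  isZero x = ⌊ x ≟ 0# ⌋

  lincomb : ∀ {N} → List Carrier → List (Fin N → Carrier) → Fin N → Carrier
  lincomb cs vs r = foldr _+_ 0# (zipWith (λ x v → x * v r) cs vs)

  isIndependent : ∀ {N} → List (Fin N → Carrier) → Bool
  isIndependent {N} vs =
    allB (λ cs → not (allB (λ r → isZero (lincomb cs vs r)) (allFin N))
                ∨ allB isZero cs)
        (allLists elements (length vs))

  column : ∀ {N M} → Matrix N M → Fin M → Fin N → Carrier
  column A j i = A i j

  selectCols : ∀ {N M} → Matrix N M → (Fin M → Bool) → List (Fin N → Carrier)
  selectCols {M = M} A S = map (column A) (filter (λ j → S j Data.Bool.≟ true) (allFin M))

  rank : ∀ {N M} → Matrix N M → ℕ
  rank {M = M} A =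
    maximum (map (λ S → let cs = selectCols A S in
                        if isIndependent cs then length cs else 0)
                 (allFuns (true ∷ false ∷ []) M))

  allMatrices : (N M : ℕ) → List (Matrix N M)
  allMatrices N M = allFuns (allFuns elements M) N

  isBlockUT : ∀ {k} (n m : Fin k → ℕ) {N M} → Matrix N M → Bool
  isBlockUT n m {N} {M} A =
    allB (λ r → allB (λ s → if ⌊ blockOf m (Fin.toℕ s) ℕ.<? blockOf n (Fin.toℕ r) ⌋
                           then isZero (A r s) else true)
                   (allFin M))
        (allFin N)

  q : ℤ
  q = + size

  fkq : ∀ {k} → ℕ → (n m : Fin k → ℕ) → ℤ
  fkq {k} a n m =
    foldr ℤ._+_ (+ 0)
      (map (λ A → poch q q (a ∸ rank A))
           (filter (λ A → isBlockUT n m A Data.Bool.≟ true)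
                   (allMatrices (sumFT 1 k (at n)) (sumFT 1 k (at m)))))

module Submission where

-- Build the matrix column by column. Block upper-triangularity says that column s may be
-- nonzero only in its first H(s) rows, with H nondecreasing, so the column space of the
-- first M columns B lies inside the space of vectors supported on the first H(M) rows.
-- A new column supported there lies in the column space of B (rank r) in q^r ways, leaving
-- the rank unchanged, and outside it in q^h - q^r ways (h = H(M)), raising the rank by one. Since
-- q^r (q;q)_(b-r) + (q^h - q^r) (q;q)_(b-r-1) = (q^h - q^b) (q;q)_(b-1-r), the weighted sum
-- over all such matrices with M columns is (q;q)_(b-M) times the product of q^H(s) - q^(b-M+1+s).
-- Within a block all columns have the same height, and each block's factors collapse to a
-- power of q times a quotient of two Pochhammer symbols, which telescopes to the formula.
--
-- The rank (the largest size of an independent set of columns) is computed by the greedy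
-- basis; it is maximal by counting, since t independent vectors span exactly q^t vectors.

module BigSums where

  open import Level using (Level; _⊔_)
  open import Algebra.Structures using (IsCommutativeSemiring)
  open import Data.Bool using (Bool; true; false; if_then_else_)
  import Data.Bool as Bool
  open import Data.Fin using (zero; suc; inject₁; fromℕ)
  open import Data.List using (List; []; _∷_; _++_; map; foldr; concatMap; filter)
  open import Data.Nat using (zero; suc)
  open import Data.Vec.Functional using (Vector) renaming (_∷_ to _∷ᵛ_)
  open import Relation.Binary.PropositionalEquality
  open import Defs using (allFuns)

  _∷ʳᵛ_ : ∀ {a} {A : Set a} {n} → Vector A n → A → Vector A (suc n)
  _∷ʳᵛ_ {n = zero}  f x _       = x
  _∷ʳᵛ_ {n = suc n} f x zero    = f zero
  _∷ʳᵛ_ {n = suc n} f x (suc i) = ((λ j → f (suc j)) ∷ʳᵛ x) i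

  ∷ʳᵛ-cong : ∀ {a} {A : Set a} {n} {f g : Vector A n} → f ≗ g → ∀ x → f ∷ʳᵛ x ≗ g ∷ʳᵛ x
  ∷ʳᵛ-cong {n = zero}  f≗g x i       = refl
  ∷ʳᵛ-cong {n = suc n} f≗g x zero    = f≗g zero
  ∷ʳᵛ-cong {n = suc n} f≗g x (suc i) = ∷ʳᵛ-cong (λ j → f≗g (suc j)) x i

  ∷ʳᵛ-inject₁ : ∀ {a} {A : Set a} {n} (f : Vector A n) x j → (f ∷ʳᵛ x) (inject₁ j) ≡ f j
  ∷ʳᵛ-inject₁ {n = suc n} f x zero    = refl
  ∷ʳᵛ-inject₁ {n = suc n} f x (suc j) = ∷ʳᵛ-inject₁ (λ i → f (suc i)) x j

  ∷ʳᵛ-fromℕ : ∀ {a} {A : Set a} {n} (f : Vector A n) x → (f ∷ʳᵛ x) (fromℕ n) ≡ x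
  ∷ʳᵛ-fromℕ {n = zero}  f x = refl
  ∷ʳᵛ-fromℕ {n = suc n} f x = ∷ʳᵛ-fromℕ (λ i → f (suc i)) x

  _∷ʳᶜ_ : ∀ {a} {A : Set a} {m n} → Vector (Vector A n) m → Vector A m → Vector (Vector A (suc n)) m
  (B ∷ʳᶜ v) r = B r ∷ʳᵛ v r

  module _ {a b} {A : Set a} {B : Set b} where

    RespectsPointwise : ∀ {n} → (Vector A n → B) → Set (a ⊔ b)
    RespectsPointwise g = ∀ {u v} → u ≗ v → g u ≡ g v

    RespectsEntrywise : ∀ {m n} → (Vector (Vector A n) m → B) → Set (a ⊔ b)
    RespectsEntrywise g = ∀ {U V} → (∀ r → U r ≗ V r) → g U ≡ g V

  module FiniteSums {A : Set} {_+_ _*_ : A → A → A} {0# 1# : A}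
    (isCommutativeSemiring : IsCommutativeSemiring _≡_ _+_ _*_ 0# 1#) where

    open IsCommutativeSemiring isCommutativeSemiring
      using (+-assoc; +-comm; +-identityˡ; +-identityʳ; distribˡ; zeroʳ; *-comm)
    open ≡-Reasoning

    private
      variable
        x y : Level
        X : Set x
        Y : Set y

      interchange : ∀ w x y z → (w + x) + (y + z) ≡ (w + y) + (x + z)
      interchange w x y z = begin
        (w + x) + (y + z)  ≡⟨ +-assoc w x (y + z) ⟩
        w + (x + (y + z))  ≡⟨ cong (w +_) (sym (+-assoc x y z)) ⟩
        w + ((x + y) + z)  ≡⟨ cong (λ t → w + (t + z)) (+-comm x y) ⟩
        w + ((y + x) + z)  ≡⟨ cong (w +_) (+-assoc y x z) ⟩
        w + (y + (x + z))  ≡⟨ sym (+-assoc w y (x + z)) ⟩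
        (w + y) + (x + z)  ∎

    ∑ : List X → (X → A) → A
    ∑ xs f = foldr _+_ 0# (map f xs)

    ∑-cong : ∀ (xs : List X) {f g} → f ≗ g → ∑ xs f ≡ ∑ xs g
    ∑-cong []       f≗g = refl
    ∑-cong (x ∷ xs) f≗g = cong₂ _+_ (f≗g x) (∑-cong xs f≗g)

    ∑-++ : ∀ (xs ys : List X) f → ∑ (xs ++ ys) f ≡ ∑ xs f + ∑ ys f
    ∑-++ []       ys f = sym (+-identityˡ _)
    ∑-++ (x ∷ xs) ys f = trans (cong (f x +_) (∑-++ xs ys f)) (sym (+-assoc _ _ _))

    ∑-0 : ∀ (xs : List X) → ∑ xs (λ _ → 0#) ≡ 0#
    ∑-0 []       = refl
    ∑-0 (x ∷ xs) = trans (+-identityˡ _) (∑-0 xs)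

    ∑-+ : ∀ (xs : List X) f g → ∑ xs (λ x → f x + g x) ≡ ∑ xs f + ∑ xs g
    ∑-+ []       f g = sym (+-identityˡ 0#)
    ∑-+ (x ∷ xs) f g = trans (cong ((f x + g x) +_) (∑-+ xs f g)) (interchange _ _ _ _)

    ∑-*ˡ : ∀ (xs : List X) c f → ∑ xs (λ x → c * f x) ≡ c * ∑ xs f
    ∑-*ˡ []       c f = sym (zeroʳ c)
    ∑-*ˡ (x ∷ xs) c f = trans (cong ((c * f x) +_) (∑-*ˡ xs c f)) (sym (distribˡ _ _ _))

    ∑-*ʳ : ∀ (xs : List X) c f → ∑ xs (λ x → f x * c) ≡ ∑ xs f * c
    ∑-*ʳ xs c f = begin
      ∑ xs (λ x → f x * c)  ≡⟨ ∑-cong xs (λ x → *-comm (f x) c) ⟩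
      ∑ xs (λ x → c * f x)  ≡⟨ ∑-*ˡ xs c f ⟩
      c * ∑ xs f            ≡⟨ *-comm c _ ⟩
      ∑ xs f * c            ∎

    ∑-filter : ∀ (p : X → Bool) xs f →
      ∑ (filter (λ x → p x Bool.≟ true) xs) f ≡ ∑ xs (λ x → if p x then f x else 0#)
    ∑-filter p []       f = refl
    ∑-filter p (x ∷ xs) f with p x
    ... | true  = cong (f x +_) (∑-filter p xs f)
    ... | false = trans (∑-filter p xs f) (sym (+-identityˡ _))

    ∑-map : ∀ (g : Y → X) ys f → ∑ (map g ys) f ≡ ∑ ys (λ y → f (g y))
    ∑-map g []       f = refl
    ∑-map g (y ∷ ys) f = cong (f (g y) +_) (∑-map g ys f)

    ∑-concatMap : ∀ (h : Y → List X) ys f → ∑ (concatMap h ys) f ≡ ∑ ys (λ y → ∑ (h y) f)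
    ∑-concatMap h []       f = refl
    ∑-concatMap h (y ∷ ys) f =
      trans (∑-++ (h y) (concatMap h ys) f) (cong (∑ (h y) f +_) (∑-concatMap h ys f))

    ∑-swap : ∀ (xs : List X) (ys : List Y) (f : X → Y → A) → ∑ xs (λ x → ∑ ys (f x)) ≡ ∑ ys (λ y → ∑ xs (λ x → f x y))
    ∑-swap []       ys f = sym (∑-0 ys)
    ∑-swap (x ∷ xs) ys f =
      trans (cong (∑ ys (f x) +_) (∑-swap xs ys f)) (sym (∑-+ ys (f x) (λ y → ∑ xs (λ x′ → f x′ y))))

    module _ {y} {Y : Set y} (ys : List Y) where

      ∑-allFuns-suc : ∀ n (g : Vector Y (suc n) → A) → RespectsPointwise g →
        ∑ (allFuns ys (suc n)) g ≡ ∑ ys (λ y → ∑ (allFuns ys n) (λ f → g (y ∷ᵛ f)))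
      ∑-allFuns-suc n g resp = trans (∑-concatMap _ ys g) (∑-cong ys λ y →
        trans (∑-map _ (allFuns ys n) g) (∑-cong (allFuns ys n) λ f →
          resp λ { zero → refl ; (suc i) → refl }))

      ∑-allFuns-∷ʳ : ∀ n (g : Vector Y (suc n) → A) → RespectsPointwise g →
        ∑ (allFuns ys (suc n)) g ≡ ∑ (allFuns ys n) (λ f → ∑ ys (λ y → g (f ∷ʳᵛ y)))
      ∑-allFuns-∷ʳ zero g resp = begin
        ∑ (allFuns ys 1) g                           ≡⟨ ∑-allFuns-suc 0 g resp ⟩
        ∑ ys (λ y → g (y ∷ᵛ (λ ())) + 0#)            ≡⟨ ∑-cong ys (λ y → trans (+-identityʳ _) (resp λ { zero → refl })) ⟩
        ∑ ys (λ y → g ((λ ()) ∷ʳᵛ y))                ≡⟨ sym (+-identityʳ _) ⟩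
        ∑ (allFuns ys 0) (λ f → ∑ ys (λ y → g (f ∷ʳᵛ y))) ∎
      ∑-allFuns-∷ʳ (suc n) g resp = begin
        ∑ (allFuns ys (suc (suc n))) g
          ≡⟨ ∑-allFuns-suc (suc n) g resp ⟩
        ∑ ys (λ y₀ → ∑ (allFuns ys (suc n)) (λ f → g (y₀ ∷ᵛ f)))
          ≡⟨ ∑-cong ys (λ y₀ → ∑-allFuns-∷ʳ n (λ f → g (y₀ ∷ᵛ f)) (λ e → resp λ { zero → refl ; (suc i) → e i })) ⟩
        ∑ ys (λ y₀ → ∑ (allFuns ys n) (λ f → ∑ ys (λ y → g (y₀ ∷ᵛ (f ∷ʳᵛ y)))))
          ≡⟨ ∑-cong ys (λ y₀ → ∑-cong (allFuns ys n) (λ f → ∑-cong ys (λ y → resp λ { zero → refl ; (suc i) → refl }))) ⟩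
        ∑ ys (λ y₀ → ∑ (allFuns ys n) (λ f → ∑ ys (λ y → g ((y₀ ∷ᵛ f) ∷ʳᵛ y))))
          ≡⟨ sym (∑-allFuns-suc n (λ f → ∑ ys (λ y → g (f ∷ʳᵛ y))) (λ e → ∑-cong ys (λ y → resp (∷ʳᵛ-cong e y)))) ⟩
        ∑ (allFuns ys (suc n)) (λ f → ∑ ys (λ y → g (f ∷ʳᵛ y))) ∎

    ∑-allFuns-∷ʳᶜ : ∀ {y} {Y : Set y} (ys : List Y) m n (g : Vector (Vector Y (suc n)) m → A) →
      RespectsEntrywise g →
      ∑ (allFuns (allFuns ys (suc n)) m) g
        ≡ ∑ (allFuns (allFuns ys n) m) (λ B → ∑ (allFuns ys m) (λ v → g (B ∷ʳᶜ v)))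
    ∑-allFuns-∷ʳᶜ ys zero n g resp =
      trans (+-identityʳ _) (sym (trans (+-identityʳ _) (trans (+-identityʳ _) (resp (λ ())))))
    ∑-allFuns-∷ʳᶜ ys (suc m) n g resp = begin
      ∑ (Rows (suc n) (suc m)) g
        ≡⟨ ∑-allFuns-suc (allFuns ys (suc n)) m g (λ e → resp (λ r → cong-app (e r))) ⟩
      ∑ (allFuns ys (suc n)) (λ row → ∑ (Rows (suc n) m) (λ A → g (row ∷ᵛ A)))
        ≡⟨ ∑-cong (allFuns ys (suc n)) (λ row → ∑-allFuns-∷ʳᶜ ys m n (λ A → g (row ∷ᵛ A))
             (λ e → resp λ { zero s → refl ; (suc r) s → e r s })) ⟩
      ∑ (allFuns ys (suc n)) (λ row → ∑ (Rows n m) (λ B → ∑ (allFuns ys m) (λ v → g (row ∷ᵛ (B ∷ʳᶜ v)))))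
        ≡⟨ ∑-allFuns-∷ʳ ys n _ (λ e → ∑-cong (Rows n m) (λ B → ∑-cong (allFuns ys m) (λ v →
             resp λ { zero s → e s ; (suc r) s → refl }))) ⟩
      ∑ (allFuns ys n) (λ f → ∑ ys (λ y → ∑ (Rows n m) (λ B → ∑ (allFuns ys m) (λ v → g ((f ∷ʳᵛ y) ∷ᵛ (B ∷ʳᶜ v))))))
        ≡⟨ ∑-cong (allFuns ys n) (λ f → ∑-swap ys (Rows n m) _) ⟩
      ∑ (allFuns ys n) (λ f → ∑ (Rows n m) (λ B → ∑ ys (λ y → ∑ (allFuns ys m) (λ v → g ((f ∷ʳᵛ y) ∷ᵛ (B ∷ʳᶜ v))))))
        ≡⟨ ∑-cong (allFuns ys n) (λ f → ∑-cong (Rows n m) (λ B → ∑-cong ys (λ y → ∑-cong (allFuns ys m) (λ v →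
             resp λ { zero s → refl ; (suc r) s → refl })))) ⟩
      ∑ (allFuns ys n) (λ f → ∑ (Rows n m) (λ B → ∑ ys (λ y → ∑ (allFuns ys m) (λ v → g ((f ∷ᵛ B) ∷ʳᶜ (y ∷ᵛ v))))))
        ≡⟨ ∑-cong (allFuns ys n) (λ f → ∑-cong (Rows n m) (λ B → sym (∑-allFuns-suc ys m _ (λ e →
             resp (λ r s → cong (λ y → ((f ∷ᵛ B) r ∷ʳᵛ y) s) (e r)))))) ⟩
      ∑ (allFuns ys n) (λ f → ∑ (Rows n m) (λ B → ∑ (allFuns ys (suc m)) (λ v → g ((f ∷ᵛ B) ∷ʳᶜ v))))
        ≡⟨ sym (∑-allFuns-suc (allFuns ys n) m _ (λ e → ∑-cong (allFuns ys (suc m)) (λ v →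
             resp (λ r s → ∷ʳᵛ-cong (cong-app (e r)) (v r) s)))) ⟩
      ∑ (Rows n (suc m)) (λ B → ∑ (allFuns ys (suc m)) (λ v → g (B ∷ʳᶜ v))) ∎
      where
      Rows : ∀ n′ m′ → List (Vector (Vector _ n′) m′)
      Rows n′ m′ = allFuns (allFuns ys n′) m′

module Counting where

  open import Data.Bool using (Bool; true; false; if_then_else_; _∧_; not)
  open import Data.Empty using (⊥-elim)
  open import Data.Fin using (Fin; zero; suc)
  open import Data.List using (List; []; _∷_; _∷ʳ_; map; concatMap; length; zipWith)
  open import Data.List.Properties using (length-++)
  import Data.List.Properties as List
  open import Data.List.Membership.Propositional using (_∈_)
  open import Data.List.Membership.Propositional.Properties using (∈-map⁺; ∈-map⁻; ∈-concatMap⁻)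
  open import Data.List.Relation.Binary.Pointwise as Pointwise using (Pointwise)
  open import Data.List.Relation.Unary.Any using (here; there; satisfied)
  open import Data.Nat using (ℕ; zero; suc; _+_; _*_; _^_; _≤_; _⊓_)
  open import Data.Nat.Properties using (+-*-isCommutativeSemiring; +-identityʳ; +-cancelʳ-≡; +-mono-≤; 1+n≢0; ⊓-idem)
  open import Data.Product using (∃; _×_; _,_)
  open import Data.Vec.Functional using (Vector; head; tail) renaming (_∷_ to _∷ᵛ_)
  open import Relation.Binary.Core using (REL)
  open import Relation.Binary.Definitions using (Decidable)
  open import Relation.Binary.PropositionalEquality
  open import Relation.Nullary using (Dec; yes; no; does)
  open import Relation.Nullary.Decidable using (map′; _×-dec_)
  open import Defs using (allFuns; allLists; allFin; allB)
  open BigSums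

  open FiniteSums +-*-isCommutativeSemiring public using ()
    renaming (∑ to ∑ℕ; ∑-cong to ∑ℕ-cong; ∑-++ to ∑ℕ-++; ∑-0 to ∑ℕ-0; ∑-+ to ∑ℕ-+; ∑-*ˡ to ∑ℕ-*ˡ; ∑-*ʳ to ∑ℕ-*ʳ;
              ∑-map to ∑ℕ-map; ∑-concatMap to ∑ℕ-concatMap; ∑-swap to ∑ℕ-swap; ∑-allFuns-suc to ∑ℕ-allFuns-suc)

  does-true⇒ : ∀ {p} {P : Set p} (P? : Dec P) → does P? ≡ true → P
  does-true⇒ (yes p) _ = p

  reflects-does : ∀ {p} {P : Set p} {b} (P? : Dec P) → (b ≡ true → P) → (P → b ≡ true) → b ≡ does P?
  reflects-does {b = true}  (yes _) b⇒P P⇒b = refl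
  reflects-does {b = true}  (no ¬p) b⇒P P⇒b = ⊥-elim (¬p (b⇒P refl))
  reflects-does {b = false} (yes p) b⇒P P⇒b = P⇒b p
  reflects-does {b = false} (no _)  b⇒P P⇒b = refl

  𝟙 : Bool → ℕ
  𝟙 b = if b then 1 else 0

  𝟙-∧ : ∀ a b → 𝟙 (a ∧ b) ≡ 𝟙 a * 𝟙 b
  𝟙-∧ true  b = sym (+-identityʳ _)
  𝟙-∧ false b = refl

  𝟙-does-mono : ∀ {p q} {P : Set p} {Q : Set q} (P? : Dec P) (Q? : Dec Q) → (P → Q) → 𝟙 (does P?) ≤ 𝟙 (does Q?)
  𝟙-does-mono (no _)  Q?      P⇒Q = Data.Nat.z≤n
  𝟙-does-mono (yes p) (yes _) P⇒Q = Data.Nat.s≤s Data.Nat.z≤n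
  𝟙-does-mono (yes p) (no ¬q) P⇒Q = ⊥-elim (¬q (P⇒Q p))

  𝟙-split : ∀ a b → 𝟙 (a ∧ b) + 𝟙 (a ∧ not b) ≡ 𝟙 a
  𝟙-split true  true  = refl
  𝟙-split true  false = refl
  𝟙-split false b     = refl

  ∑ℕ-mono : ∀ {a} {A : Set a} (xs : List A) {f g : A → ℕ} → (∀ x → f x ≤ g x) → ∑ℕ xs f ≤ ∑ℕ xs g
  ∑ℕ-mono []       f≤g = Data.Nat.z≤n
  ∑ℕ-mono (x ∷ xs) f≤g = +-mono-≤ (f≤g x) (∑ℕ-mono xs f≤g)

  ∑ℕ-cong-∈ : ∀ {a} {A : Set a} (xs : List A) {f g : A → ℕ} → (∀ {x} → x ∈ xs → f x ≡ g x) → ∑ℕ xs f ≡ ∑ℕ xs g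
  ∑ℕ-cong-∈ []       f≡g = refl
  ∑ℕ-cong-∈ (x ∷ xs) f≡g = cong₂ _+_ (f≡g (here refl)) (∑ℕ-cong-∈ xs (λ x∈ → f≡g (there x∈)))

  ∑ℕ-product : ∀ {a b} {A : Set a} {B : Set b} (xs : List A) (ys : List B) f g →
    ∑ℕ xs (λ x → ∑ℕ ys (λ y → f x * g y)) ≡ ∑ℕ xs f * ∑ℕ ys g
  ∑ℕ-product xs ys f g = trans (∑ℕ-cong xs (λ x → ∑ℕ-*ˡ ys (f x) g)) (∑ℕ-*ʳ xs (∑ℕ ys g) f)

  ∑ℕ-𝟙-∃ : ∀ {a} {A : Set a} (xs : List A) (p : A → Bool) → ∑ℕ xs (λ x → 𝟙 (p x)) ≢ 0 →
    ∃ λ x → x ∈ xs × p x ≡ true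
  ∑ℕ-𝟙-∃ []       p ≢0 = ⊥-elim (≢0 refl)
  ∑ℕ-𝟙-∃ (x ∷ xs) p ≢0 with p x in px
  ... | true  = x , here refl , px
  ... | false with ∑ℕ-𝟙-∃ xs p ≢0
  ...   | y , y∈ , py = y , there y∈ , py

  ∑ℕ-𝟙-false : ∀ {a} {A : Set a} (xs : List A) (p : A → Bool) → (∀ {x} → x ∈ xs → p x ≡ false) →
    ∑ℕ xs (λ x → 𝟙 (p x)) ≡ 0
  ∑ℕ-𝟙-false []       p ¬p = refl
  ∑ℕ-𝟙-false (x ∷ xs) p ¬p rewrite ¬p (here refl) = ∑ℕ-𝟙-false xs p (λ x∈ → ¬p (there x∈))

  ∑ℕ-const : ∀ {a} {A : Set a} (xs : List A) c → ∑ℕ xs (λ _ → c) ≡ length xs * c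
  ∑ℕ-const []       c = refl
  ∑ℕ-const (x ∷ xs) c = cong (c +_) (∑ℕ-const xs c)

  allB-true⇒ : ∀ {a} {A : Set a} (p : A → Bool) xs → allB p xs ≡ true → ∀ {x} → x ∈ xs → p x ≡ true
  allB-true⇒ p (y ∷ xs) all-p x∈ with p y in py
  allB-true⇒ p (y ∷ xs) all-p (here refl) | true = py
  allB-true⇒ p (y ∷ xs) all-p (there x∈) | true = allB-true⇒ p xs all-p x∈

  allB-true⇐ : ∀ {a} {A : Set a} (p : A → Bool) xs → (∀ {x} → x ∈ xs → p x ≡ true) → allB p xs ≡ true
  allB-true⇐ p []       all-p = refl
  allB-true⇐ p (x ∷ xs) all-p rewrite all-p (here refl) = allB-true⇐ p xs (λ x∈ → all-p (there x∈))

  length-∷ʳ-injective : ∀ {a b} {A : Set a} {B : Set b} (xs : List A) (ys : List B) {x y} →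
    length (xs ∷ʳ x) ≡ length (ys ∷ʳ y) → length xs ≡ length ys
  length-∷ʳ-injective xs ys eq =
    +-cancelʳ-≡ _ _ _ (trans (sym (length-++ xs)) (trans eq (length-++ ys)))

  length-zipWith-≡ : ∀ {a b c} {A : Set a} {B : Set b} {C : Set c} (f : A → B → C) xs ys {n} →
    length xs ≡ n → length ys ≡ n → length (zipWith f xs ys) ≡ n
  length-zipWith-≡ f xs ys refl |ys| = trans (List.length-zipWith f xs ys) (trans (cong (length xs ⊓_) |ys|) (⊓-idem _))

  allFin-complete : ∀ {n} (i : Fin n) → i ∈ allFin n
  allFin-complete zero    = here refl
  allFin-complete (suc i) = there (∈-map⁺ suc (allFin-complete i))

  map-allFuns-suc : ∀ {a b} {A : Set a} {B : Set b} (xs : List A) n (g : Vector A (suc n) → B) →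
    RespectsPointwise g →
    map g (allFuns xs (suc n)) ≡ concatMap (λ x → map (λ f → g (x ∷ᵛ f)) (allFuns xs n)) xs
  map-allFuns-suc xs n g resp = trans (List.map-concatMap g _ xs) (List.concatMap-cong (λ x →
    trans (sym (List.map-∘ (allFuns xs n)))
          (List.map-cong (λ f → resp λ { zero → refl ; (suc i) → refl }) (allFuns xs n))) xs)

  module _ {a} {A : Set a} (xs : List A) where

    count-allLists : ∀ n → ∑ℕ (allLists xs n) (λ _ → 1) ≡ length xs ^ n
    count-allLists zero    = refl
    count-allLists (suc n) = begin
      ∑ℕ (allLists xs (suc n)) (λ _ → 1)                   ≡⟨ ∑ℕ-concatMap _ xs _ ⟩
      ∑ℕ xs (λ x → ∑ℕ (map (x ∷_) (allLists xs n)) (λ _ → 1)) ≡⟨ ∑ℕ-cong xs (λ x → ∑ℕ-map _ (allLists xs n) _) ⟩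
      ∑ℕ xs (λ _ → ∑ℕ (allLists xs n) (λ _ → 1))            ≡⟨ ∑ℕ-const xs _ ⟩
      length xs * ∑ℕ (allLists xs n) (λ _ → 1)              ≡⟨ cong (length xs *_) (count-allLists n) ⟩
      length xs * length xs ^ n                             ∎
      where open ≡-Reasoning

    allLists-length : ∀ n {cs} → cs ∈ allLists xs n → length cs ≡ n
    allLists-length zero    (here refl) = refl
    allLists-length (suc n) cs∈ with satisfied (∈-concatMap⁻ (λ x → map (x ∷_) (allLists xs n)) {xs = xs} cs∈)
    ... | x , cs∈′ with ∈-map⁻ (x ∷_) cs∈′
    ...   | ds , ds∈ , refl = cong suc (allLists-length n ds∈)

  module Matching {a b ℓ} {A : Set a} {B : Set b} {R : REL A B ℓ} (R? : Decidable R)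
    (xs : List A) (unique : ∀ y → ∑ℕ xs (λ x → 𝟙 (does (R? x y))) ≡ 1) where

    open ≡-Reasoning

    pointwise? : ∀ {n} → Decidable (λ (u : Vector A n) (v : Vector B n) → ∀ i → R (u i) (v i))
    pointwise? {zero}  u v = yes (λ ())
    pointwise? {suc n} u v = map′ (λ { (r₀ , rs) → λ { zero → r₀ ; (suc i) → rs i } })
                                  (λ r → r zero , λ i → r (suc i))
                                  (R? (head u) (head v) ×-dec pointwise? (tail u) (tail v))

    matches-allLists : ∀ ys → ∑ℕ (allLists xs (length ys)) (λ cs → 𝟙 (does (Pointwise.decidable R? cs ys))) ≡ 1
    matches-allLists []       = refl
    matches-allLists (y ∷ ys) = begin
      ∑ℕ (allLists xs (suc (length ys))) (λ cs → 𝟙 (does (Pointwise.decidable R? cs (y ∷ ys))))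
        ≡⟨ ∑ℕ-concatMap _ xs _ ⟩
      ∑ℕ xs (λ x → ∑ℕ (map (x ∷_) (allLists xs (length ys))) (λ cs → 𝟙 (does (Pointwise.decidable R? cs (y ∷ ys)))))
        ≡⟨ ∑ℕ-cong xs (λ x → trans (∑ℕ-map _ (allLists xs (length ys)) _)
             (∑ℕ-cong (allLists xs (length ys)) (λ cs → 𝟙-∧ (does (R? x y)) _))) ⟩
      ∑ℕ xs (λ x → ∑ℕ (allLists xs (length ys)) (λ cs → 𝟙 (does (R? x y)) * 𝟙 (does (Pointwise.decidable R? cs ys))))
        ≡⟨ ∑ℕ-product xs (allLists xs (length ys)) _ _ ⟩
      ∑ℕ xs (λ x → 𝟙 (does (R? x y))) * ∑ℕ (allLists xs (length ys)) (λ cs → 𝟙 (does (Pointwise.decidable R? cs ys)))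
        ≡⟨ cong₂ _*_ (unique y) (matches-allLists ys) ⟩
      1 ∎

    matches-allFuns : ∀ n (v : Vector B n) → ∑ℕ (allFuns xs n) (λ u → 𝟙 (does (pointwise? u v))) ≡ 1
    matches-allFuns zero    v = refl
    matches-allFuns (suc n) v = begin
      ∑ℕ (allFuns xs (suc n)) (λ u → 𝟙 (does (pointwise? u v)))
        ≡⟨ ∑ℕ-concatMap _ xs _ ⟩
      ∑ℕ xs (λ x → ∑ℕ (map _ (allFuns xs n)) (λ u → 𝟙 (does (pointwise? u v))))
        ≡⟨ ∑ℕ-cong xs (λ x → trans (∑ℕ-map _ (allFuns xs n) _)
             (∑ℕ-cong (allFuns xs n) (λ u → 𝟙-∧ (does (R? x (head v))) _))) ⟩
      ∑ℕ xs (λ x → ∑ℕ (allFuns xs n) (λ u → 𝟙 (does (R? x (head v))) * 𝟙 (does (pointwise? u (tail v)))))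
        ≡⟨ ∑ℕ-product xs (allFuns xs n) _ _ ⟩
      ∑ℕ xs (λ x → 𝟙 (does (R? x (head v)))) * ∑ℕ (allFuns xs n) (λ u → 𝟙 (does (pointwise? u (tail v))))
        ≡⟨ cong₂ _*_ (unique (head v)) (matches-allFuns n (tail v)) ⟩
      1 ∎

    matching-∈-allLists : ∀ ys → ∃ λ cs → cs ∈ allLists xs (length ys) × Pointwise R cs ys
    matching-∈-allLists ys with ∑ℕ-𝟙-∃ (allLists xs (length ys)) (λ cs → does (Pointwise.decidable R? cs ys))
                                 (λ ≡0 → 1+n≢0 (trans (sym (matches-allLists ys)) ≡0))
    ... | cs , cs∈ , match = cs , cs∈ , does-true⇒ (Pointwise.decidable R? cs ys) match

module Linear where

  open import Level using (_⊔_)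
  import Algebra.Properties.Ring as RingProperties
  open import Data.Bool using (Bool; true; false; not; _∨_)
  open import Data.Empty using (⊥-elim)
  open import Data.List using (List; []; _∷_; _++_; [_]; _∷ʳ_; map; length; zipWith; replicate; _∷ʳ′_; initLast)
  import Data.List.Properties as List
  open import Data.List.Membership.Propositional using (_∈_; find; lose)
  open import Data.List.Relation.Binary.Pointwise as Pointwise using (Pointwise; []; _∷_)
  open import Data.List.Relation.Unary.All as All using (All; []; _∷_)
  import Data.List.Relation.Unary.All.Properties as All
  open import Data.List.Relation.Unary.AllPairs using (AllPairs; []; _∷_)
  open import Data.List.Relation.Unary.Any using (Any; here; there; any?)
  open import Data.Nat using (ℕ; zero; suc; _≤_; _^_; z≤n; s≤s) renaming (_+_ to _+ℕ_)
  import Data.Nat.Properties as ℕ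
  open import Data.Product using (Σ-syntax; _×_; _,_)
  open import Data.Vec.Functional using (Vector)
  open import Relation.Binary.Definitions using (Decidable)
  import Relation.Binary.PropositionalEquality as ≡
  open ≡ using (_≡_)
  open import Relation.Nullary using (Dec; yes; no; does; ¬_)
  open import Relation.Nullary.Decidable using (map′; isYes≗does; dec-true; dec-false; does-⇔)
  open import Function.Bundles using (mk⇔)
  import Relation.Binary.Reasoning.Setoid
  open import Defs
  open BigSums
  open Counting

  module LinearAlgebra {c ℓ} (F : FiniteField c ℓ) where

    open FiniteField F
    open FF F
    open RingProperties ring using (-1*x≈-x; x∙y⁻¹≈ε⇒x≈y; +-inverseʳ-unique)
    module ≈-Reasoning = Relation.Binary.Reasoning.Setoid setoid

    elements-unique : ∀ y → ∑ℕ elements (λ x → 𝟙 (does (x ≟ y))) ≡ 1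
    elements-unique y = count distinct (complete y)
      where
      count-absent : ∀ {xs} → All (λ x → ¬ x ≈ y) xs → ∑ℕ xs (λ x → 𝟙 (does (x ≟ y))) ≡ 0
      count-absent []                      = ≡.refl
      count-absent {x ∷ _} (x≉y ∷ x≉ys) rewrite dec-false (x ≟ y) x≉y = count-absent x≉ys

      ≉-∈ : ∀ {x zs} → All (λ z → ¬ x ≈ z) zs → Any (y ≈_) zs → ¬ x ≈ y
      ≉-∈ (x≉z ∷ _)  (here y≈z) x≈y = x≉z (trans x≈y y≈z)
      ≉-∈ (_ ∷ x≉zs) (there y∈) x≈y = ≉-∈ x≉zs y∈ x≈y

      count : ∀ {xs} → AllPairs (λ x z → ¬ x ≈ z) xs → Any (y ≈_) xs → ∑ℕ xs (λ x → 𝟙 (does (x ≟ y))) ≡ 1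
      count {x ∷ xs} (x≉xs ∷ _) (here y≈x) rewrite dec-true (x ≟ y) (sym y≈x) =
        ≡.cong suc (count-absent (All.map (λ x≉z z≈y → x≉z (trans (sym y≈x) (sym z≈y))) x≉xs))
      count {x ∷ xs} (x≉xs ∷ d) (there y∈xs) rewrite dec-false (x ≟ y) (≉-∈ x≉xs y∈xs) = count d y∈xs

    2≤size : 2 ≤ size
    2≤size with elements | complete 0# | complete 1#
    ... | []        | ()       | _
    ... | _ ∷ []    | here 0≈x | here 1≈x = ⊥-elim (0≉1 (trans 0≈x (sym 1≈x)))
    ... | _ ∷ _ ∷ _ | _        | _        = s≤s (s≤s z≤n)

    isZero⇒≈0 : ∀ {x} → isZero x ≡ true → x ≈ 0#
    isZero⇒≈0 {x} isZ = does-true⇒ (x ≟ 0#) (≡.trans (≡.sym (isYes≗does (x ≟ 0#))) isZ)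

    ≈0⇒isZero : ∀ {x} → x ≈ 0# → isZero x ≡ true
    ≈0⇒isZero {x} x≈0 = ≡.trans (isYes≗does (x ≟ 0#)) (dec-true (x ≟ 0#) x≈0)

    module Space (N : ℕ) where

      V : Set c
      V = Vector Carrier N

      infix 4 _≋_ _≋?_
      _≋_ : V → V → Set ℓ
      u ≋ v = ∀ i → u i ≈ v i

      open Matching _≟_ elements elements-unique public

      _≋?_ : Decidable _≋_
      _≋?_ = pointwise?

      ≋-sym : ∀ {u v} → u ≋ v → v ≋ u
      ≋-sym u≋v i = sym (u≋v i)

      private
        interchange : ∀ w x y z → (w + x) + (y + z) ≈ (w + y) + (x + z)
        interchange w x y z = begin
          (w + x) + (y + z)  ≈⟨ +-assoc w x (y + z) ⟩
          w + (x + (y + z))  ≈⟨ +-congˡ (sym (+-assoc x y z)) ⟩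
          w + ((x + y) + z)  ≈⟨ +-congˡ (+-congʳ (+-comm x y)) ⟩
          w + ((y + x) + z)  ≈⟨ +-congˡ (+-assoc y x z) ⟩
          w + (y + (x + z))  ≈⟨ sym (+-assoc w y (x + z)) ⟩
          (w + y) + (x + z)  ∎
          where open ≈-Reasoning

        0+0≈0 : 0# + 0# ≈ 0#
        0+0≈0 = +-identityˡ 0#

      lincomb-zipWith-+ : ∀ cs ds (U : List V) i → length cs ≡ length U → length ds ≡ length U →
        lincomb (zipWith _+_ cs ds) U i ≈ lincomb cs U i + lincomb ds U i
      lincomb-zipWith-+ []       []       []       i _ _ = sym 0+0≈0
      lincomb-zipWith-+ (c ∷ cs) (d ∷ ds) (u ∷ U) i |cs| |ds| = begin
        (c + d) * u i + lincomb (zipWith _+_ cs ds) U i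
          ≈⟨ +-cong (distribʳ (u i) c d) (lincomb-zipWith-+ cs ds U i (ℕ.suc-injective |cs|) (ℕ.suc-injective |ds|)) ⟩
        (c * u i + d * u i) + (lincomb cs U i + lincomb ds U i)
          ≈⟨ interchange _ _ _ _ ⟩
        (c * u i + lincomb cs U i) + (d * u i + lincomb ds U i) ∎
        where open ≈-Reasoning

      lincomb-map-* : ∀ k cs (U : List V) i → lincomb (map (k *_) cs) U i ≈ k * lincomb cs U i
      lincomb-map-* k []       U       i = sym (zeroʳ k)
      lincomb-map-* k (c ∷ cs) []      i = sym (zeroʳ k)
      lincomb-map-* k (c ∷ cs) (u ∷ U) i = begin
        (k * c) * u i + lincomb (map (k *_) cs) U i  ≈⟨ +-cong (*-assoc k c (u i)) (lincomb-map-* k cs U i) ⟩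
        k * (c * u i) + k * lincomb cs U i           ≈⟨ sym (distribˡ k _ _) ⟩
        k * (c * u i + lincomb cs U i)               ∎
        where open ≈-Reasoning

      lincomb-replicate-0 : ∀ n (U : List V) i → lincomb (replicate n 0#) U i ≈ 0#
      lincomb-replicate-0 zero    U       i = refl
      lincomb-replicate-0 (suc n) []      i = refl
      lincomb-replicate-0 (suc n) (u ∷ U) i =
        trans (+-cong (zeroˡ (u i)) (lincomb-replicate-0 n U i)) 0+0≈0

      lincomb-vanishing : ∀ cs (U : List V) i → All (λ u → u i ≈ 0#) U → lincomb cs U i ≈ 0#
      lincomb-vanishing []       U       i _            = refl
      lincomb-vanishing (c ∷ cs) []      i _            = refl
      lincomb-vanishing (c ∷ cs) (u ∷ U) i (uᵢ≈0 ∷ U≈0) =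
        trans (+-cong (trans (*-congˡ uᵢ≈0) (zeroʳ c)) (lincomb-vanishing cs U i U≈0)) 0+0≈0

      lincomb-congˡ : ∀ {cs ds} (U : List V) i → Pointwise _≈_ cs ds → lincomb cs U i ≈ lincomb ds U i
      lincomb-congˡ U       i []            = refl
      lincomb-congˡ []      i (_ ∷ _)       = refl
      lincomb-congˡ (u ∷ U) i (c≈d ∷ cs≈ds) = +-cong (*-congʳ c≈d) (lincomb-congˡ U i cs≈ds)

      lincomb-congʳ : ∀ cs {U W : List V} i → Pointwise _≋_ U W → lincomb cs U i ≈ lincomb cs W i
      lincomb-congʳ []       i _             = refl
      lincomb-congʳ (c ∷ cs) i []            = refl
      lincomb-congʳ (c ∷ cs) i (u≋w ∷ U≋W)   = +-cong (*-congˡ (u≋w i)) (lincomb-congʳ cs i U≋W)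

      lincomb-++ : ∀ cs ds (U W : List V) i → length cs ≡ length U →
        lincomb (cs ++ ds) (U ++ W) i ≈ lincomb cs U i + lincomb ds W i
      lincomb-++ []       ds []      W i _    = sym (+-identityˡ _)
      lincomb-++ (c ∷ cs) ds (u ∷ U) W i |cs| = begin
        c * u i + lincomb (cs ++ ds) (U ++ W) i           ≈⟨ +-congˡ (lincomb-++ cs ds U W i (ℕ.suc-injective |cs|)) ⟩
        c * u i + (lincomb cs U i + lincomb ds W i)       ≈⟨ sym (+-assoc _ _ _) ⟩
        (c * u i + lincomb cs U i) + lincomb ds W i       ∎
        where open ≈-Reasoning

      lincomb-∷ʳ : ∀ cs d (U : List V) w i → length cs ≡ length U →
        lincomb (cs ∷ʳ d) (U ∷ʳ w) i ≈ lincomb cs U i + d * w i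
      lincomb-∷ʳ cs d U w i |cs| = trans (lincomb-++ cs [ d ] U [ w ] i |cs|) (+-congˡ (+-identityʳ _))

      InSpan : List V → V → Set (c ⊔ ℓ)
      InSpan U v = Σ[ cs ∈ List Carrier ] length cs ≡ length U × v ≋ lincomb cs U

      InSpan-resp : ∀ {U W u w} → Pointwise _≋_ U W → u ≋ w → InSpan U u → InSpan W w
      InSpan-resp U≋W u≋w (cs , |cs| , u≋cs) =
        cs , ≡.trans |cs| (Pointwise.Pointwise-length U≋W) ,
        λ i → trans (sym (u≋w i)) (trans (u≋cs i) (lincomb-congʳ cs i U≋W))

      span-0 : ∀ U → InSpan U (λ _ → 0#)
      span-0 U = replicate (length U) 0# , List.length-replicate (length U) ,
                 λ i → sym (lincomb-replicate-0 (length U) U i)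

      span-+ : ∀ U {u w} → InSpan U u → InSpan U w → InSpan U (λ i → u i + w i)
      span-+ U (cs , |cs| , u≋) (ds , |ds| , w≋) =
        zipWith _+_ cs ds ,
        length-zipWith-≡ _+_ cs ds |cs| |ds| ,
        λ i → trans (+-cong (u≋ i) (w≋ i)) (sym (lincomb-zipWith-+ cs ds U i |cs| |ds|))

      span-* : ∀ U k {u} → InSpan U u → InSpan U (λ i → k * u i)
      span-* U k (cs , |cs| , u≋) =
        map (k *_) cs , ≡.trans (List.length-map (k *_) cs) |cs| ,
        λ i → trans (*-congˡ (u≋ i)) (sym (lincomb-map-* k cs U i))

      span-∈ : ∀ {U u} → u ∈ U → InSpan U u
      span-∈ {u ∷ U} (here ≡.refl) =
        1# ∷ replicate (length U) 0# , ≡.cong suc (List.length-replicate _) ,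
        λ i → sym (trans (+-cong (*-identityˡ (u i)) (lincomb-replicate-0 (length U) U i)) (+-identityʳ _))
      span-∈ {w ∷ U} (there u∈U) with span-∈ u∈U
      ... | cs , |cs| , u≋ =
        0# ∷ cs , ≡.cong suc |cs| , λ i → trans (u≋ i) (sym (trans (+-congʳ (zeroˡ (w i))) (+-identityˡ _)))

      span-lincomb : ∀ U T cs → All (InSpan U) T → InSpan U (lincomb cs T)
      span-lincomb U T       []       _              = span-0 U
      span-lincomb U []      (c ∷ cs) _              = span-0 U
      span-lincomb U (t ∷ T) (c ∷ cs) (t∈ ∷ T⊆) = span-+ U (span-* U c t∈) (span-lincomb U T cs T⊆)

      span-trans : ∀ U T {v} → All (InSpan U) T → InSpan T v → InSpan U v
      span-trans U T T⊆ (cs , _ , v≋) = InSpan-resp (Pointwise.refl (λ _ → refl)) (≋-sym v≋) (span-lincomb U T cs T⊆)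

      span-++ʳ : ∀ U W {v} → InSpan U v → InSpan (U ++ W) v
      span-++ʳ U W (cs , |cs| , v≋) =
        cs ++ replicate (length W) 0# ,
        ≡.trans (List.length-++ cs) (≡.trans (≡.cong₂ _+ℕ_ |cs| (List.length-replicate _)) (≡.sym (List.length-++ U))) ,
        λ i → trans (v≋ i) (sym (trans (lincomb-++ cs _ U W i |cs|)
                (trans (+-congˡ (lincomb-replicate-0 (length W) W i)) (+-identityʳ _))))

      -- Opaque so that `with inSpan? U v` abstracts the decision in goals instead of its unfolding.
      opaque
        inSpan? : ∀ U v → Dec (InSpan U v)
        inSpan? U v = map′ from-any to-any (any? (λ cs → v ≋? lincomb cs U) (allLists elements (length U)))
          where
          from-any : Any (λ cs → v ≋ lincomb cs U) (allLists elements (length U)) → InSpan U v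
          from-any any with find any
          ... | cs , cs∈ , v≋ = cs , allLists-length elements (length U) cs∈ , v≋

          to-any : InSpan U v → Any (λ cs → v ≋ lincomb cs U) (allLists elements (length U))
          to-any (ds , |ds| , v≋) with matching-∈-allLists ds
          ... | cs , cs∈ , cs≈ds = lose (≡.subst (λ n → cs ∈ allLists elements n) |ds| cs∈)
                                        (λ i → trans (v≋ i) (lincomb-congˡ U i (Pointwise.symmetric sym cs≈ds)))

      Independent : List V → Set (c ⊔ ℓ)
      Independent U = ∀ cs → length cs ≡ length U → lincomb cs U ≋ (λ _ → 0#) → All (_≈ 0#) cs

      independent-[] : Independent []
      independent-[] [] _ _ = []

      independent-unique : ∀ {U} → Independent U → ∀ cs ds → length cs ≡ length U → length ds ≡ length U →
        lincomb cs U ≋ lincomb ds U → Pointwise _≈_ cs ds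
      independent-unique {U} indep cs ds |cs| |ds| cs≋ds =
        coefficientwise cs ds (≡.trans |cs| (≡.sym |ds|)) (indep es |es| es≋0)
        where
        es = zipWith _+_ cs (map (- 1# *_) ds)
        |-ds| = ≡.trans (List.length-map _ ds) |ds|
        |es| = length-zipWith-≡ _+_ cs _ |cs| |-ds|
        es≋0 : lincomb es U ≋ (λ _ → 0#)
        es≋0 i = begin
          lincomb es U i                                   ≈⟨ lincomb-zipWith-+ cs _ U i |cs| |-ds| ⟩
          lincomb cs U i + lincomb (map (- 1# *_) ds) U i  ≈⟨ +-cong (cs≋ds i) (lincomb-map-* (- 1#) ds U i) ⟩
          lincomb ds U i + - 1# * lincomb ds U i           ≈⟨ +-congˡ (-1*x≈-x _) ⟩
          lincomb ds U i + - lincomb ds U i                ≈⟨ -‿inverseʳ _ ⟩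
          0#                                               ∎
          where open ≈-Reasoning
        coefficientwise : ∀ cs ds → length cs ≡ length ds → All (_≈ 0#) (zipWith _+_ cs (map (- 1# *_) ds)) →
          Pointwise _≈_ cs ds
        coefficientwise []       []       _  _ = []
        coefficientwise (c ∷ cs) (d ∷ ds) eq (c-d≈0 ∷ rest) =
          x∙y⁻¹≈ε⇒x≈y c d (trans (+-congˡ (sym (-1*x≈-x d))) c-d≈0) ∷ coefficientwise cs ds (ℕ.suc-injective eq) rest

      independent-∷ʳ : ∀ {U x} → Independent U → ¬ InSpan U x → Independent (U ∷ʳ x)
      independent-∷ʳ {U} {x} indep x∉ cs |cs| cs≋0 with initLast cs
      ... | [] = ⊥-elim (ℕ.1+n≢0 (≡.sym (≡.trans |cs| (≡.trans (List.length-++ U) (ℕ.+-comm _ 1)))))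
      ... | cs₁ ∷ʳ′ d with length-∷ʳ-injective cs₁ U |cs| | d ≟ 0#
      ...   | |cs₁| | yes d≈0 = All.++⁺ (indep cs₁ |cs₁| cs₁≋0) (d≈0 ∷ [])
        where
        cs₁≋0 : lincomb cs₁ U ≋ (λ _ → 0#)
        cs₁≋0 i = begin
          lincomb cs₁ U i               ≈⟨ sym (+-identityʳ _) ⟩
          lincomb cs₁ U i + 0#          ≈⟨ +-congˡ (sym (trans (*-congʳ d≈0) (zeroˡ (x i)))) ⟩
          lincomb cs₁ U i + d * x i     ≈⟨ sym (lincomb-∷ʳ cs₁ d U x i |cs₁|) ⟩
          lincomb (cs₁ ∷ʳ d) (U ∷ʳ x) i ≈⟨ cs≋0 i ⟩
          0#                            ∎
          where open ≈-Reasoning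
      ...   | |cs₁| | no d≉0 with inverse d d≉0
      ...     | y , dy≈1 = ⊥-elim (x∉ (InSpan-resp (Pointwise.refl (λ _ → refl)) (≋-sym x≋)
                             (span-* U (y * - 1#) (cs₁ , |cs₁| , λ _ → refl))))
        where
        dx≈-L : ∀ i → d * x i ≈ - lincomb cs₁ U i
        dx≈-L i = +-inverseʳ-unique _ _ (trans (sym (lincomb-∷ʳ cs₁ d U x i |cs₁|)) (cs≋0 i))
        x≋ : x ≋ (λ i → (y * - 1#) * lincomb cs₁ U i)
        x≋ i = begin
          x i                           ≈⟨ sym (*-identityˡ _) ⟩
          1# * x i                      ≈⟨ *-congʳ (sym (trans (*-comm y d) dy≈1)) ⟩
          (y * d) * x i                 ≈⟨ *-assoc y d (x i) ⟩
          y * (d * x i)                 ≈⟨ *-congˡ (trans (dx≈-L i) (sym (-1*x≈-x _))) ⟩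
          y * (- 1# * lincomb cs₁ U i)  ≈⟨ sym (*-assoc _ _ _) ⟩
          (y * - 1#) * lincomb cs₁ U i  ∎
          where open ≈-Reasoning

      private
        vanishes? : List Carrier → List V → Bool
        vanishes? cs U = allB (λ i → isZero (lincomb cs U i)) (allFin N)

        vanishes?-true⇒ : ∀ cs U → vanishes? cs U ≡ true → lincomb cs U ≋ (λ _ → 0#)
        vanishes?-true⇒ cs U v i = isZero⇒≈0 (allB-true⇒ _ (allFin N) v (allFin-complete i))

        vanishes?-true⇐ : ∀ cs U → lincomb cs U ≋ (λ _ → 0#) → vanishes? cs U ≡ true
        vanishes?-true⇐ cs U cs≋0 = allB-true⇐ _ (allFin N) (λ {i} _ → ≈0⇒isZero (cs≋0 i))

      independent⇒isIndependent : ∀ U → Independent U → isIndependent U ≡ true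
      independent⇒isIndependent U indep = allB-true⇐ _ (allLists elements (length U)) test
        where
        test : ∀ {cs} → cs ∈ allLists elements (length U) → (not (vanishes? cs U) ∨ allB isZero cs) ≡ true
        test {cs} cs∈ with vanishes? cs U in v
        ... | false = ≡.refl
        ... | true  = allB-true⇐ isZero cs λ c∈ → ≈0⇒isZero (All.lookup zeros c∈)
          where
          zeros = indep cs (allLists-length elements (length U) cs∈) (vanishes?-true⇒ cs U v)

      isIndependent⇒independent : ∀ U → isIndependent U ≡ true → Independent U
      isIndependent⇒independent U isInd ds |ds| ds≋0 with matching-∈-allLists ds
      ... | cs , cs∈ , cs≈ds = transfer cs≈ds zeros
        where
        cs∈′ = ≡.subst (λ n → cs ∈ allLists elements n) |ds| cs∈
        cs-vanishes = vanishes?-true⇐ cs U (λ i → trans (lincomb-congˡ U i cs≈ds) (ds≋0 i))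
        zeros : All (_≈ 0#) cs
        zeros = All.tabulate λ c∈ → isZero⇒≈0 (allB-true⇒ isZero cs
          (≡.subst (λ b → (not b ∨ allB isZero cs) ≡ true) cs-vanishes
            (allB-true⇒ _ (allLists elements (length U)) isInd cs∈′)) c∈)
        transfer : ∀ {xs ys} → Pointwise _≈_ xs ys → All (_≈ 0#) xs → All (_≈ 0#) ys
        transfer []              []             = []
        transfer (x≈y ∷ xs≈ys) (x≈0 ∷ xs≈0) = trans (sym x≈y) x≈0 ∷ transfer xs≈ys xs≈0

      count-span : ∀ U → Independent U → ∑ℕ (allFuns elements N) (λ v → 𝟙 (does (inSpan? U v))) ≡ size ^ length U
      count-span U indep = begin
        ∑ℕ (allFuns elements N) (λ v → 𝟙 (does (inSpan? U v)))
          ≡⟨ ∑ℕ-cong (allFuns elements N) representations ⟩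
        ∑ℕ (allFuns elements N) (λ v → ∑ℕ Cs (λ cs → 𝟙 (does (v ≋? lincomb cs U))))
          ≡⟨ ∑ℕ-swap (allFuns elements N) Cs _ ⟩
        ∑ℕ Cs (λ cs → ∑ℕ (allFuns elements N) (λ v → 𝟙 (does (v ≋? lincomb cs U))))
          ≡⟨ ∑ℕ-cong Cs (λ cs → matches-allFuns N (lincomb cs U)) ⟩
        ∑ℕ Cs (λ _ → 1)
          ≡⟨ count-allLists elements (length U) ⟩
        size ^ length U ∎
        where
        open ≡.≡-Reasoning
        Cs = allLists elements (length U)

        representations : ∀ v → 𝟙 (does (inSpan? U v)) ≡ ∑ℕ Cs (λ cs → 𝟙 (does (v ≋? lincomb cs U)))
        representations v with inSpan? U v
        ... | no v∉ = ≡.sym (∑ℕ-𝟙-false Cs _ λ {cs} cs∈ →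
                        dec-false (v ≋? lincomb cs U) (λ v≋ → v∉ (cs , allLists-length elements _ cs∈ , v≋)))
        ... | yes (ds , |ds| , v≋) = ≡.sym (≡.trans (∑ℕ-cong-∈ Cs same-test)
                                       (≡.subst (λ n → ∑ℕ (allLists elements n) _ ≡ 1) |ds| (matches-allLists ds)))
          where
          same-test : ∀ {cs} → cs ∈ Cs → 𝟙 (does (v ≋? lincomb cs U)) ≡ 𝟙 (does (Pointwise.decidable _≟_ cs ds))
          same-test {cs} cs∈ = ≡.cong 𝟙 (does-⇔ (mk⇔
            (λ v≋cs → independent-unique indep cs ds (allLists-length elements _ cs∈) |ds|
                        (λ i → trans (sym (v≋cs i)) (v≋ i)))
            (λ cs≈ds i → trans (v≋ i) (lincomb-congˡ U i (Pointwise.symmetric sym cs≈ds))))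
            (v ≋? lincomb cs U) (Pointwise.decidable _≟_ cs ds))

module Ranks where

  open import Data.Bool using (Bool; true; false; if_then_else_)
  import Data.Bool as Bool
  open import Data.Empty using (⊥-elim)
  open import Data.Fin using (Fin; zero; suc)
  open import Data.List using (List; []; _∷_; _++_; [_]; _∷ʳ_; map; filter; length)
  import Data.List.Properties as List
  open import Data.List.Membership.Propositional using (_∈_)
  open import Data.List.Membership.Propositional.Properties using (∈-map⁺; ∈-map⁻; ∈-++⁺ˡ; ∈-++⁺ʳ; ∈-++⁻)
  open import Data.List.Relation.Binary.Pointwise as Pointwise using (Pointwise; []; _∷_)
  open import Data.List.Relation.Unary.All as All using (All; []; _∷_)
  open import Data.List.Relation.Unary.Any using (here; there)
  open import Data.Nat using (ℕ; zero; suc; _≤_; _<_; _⊔_; _^_; z≤n; s≤s)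
  import Data.Nat.Properties as ℕ
  open import Data.Product using (∃; _×_; _,_)
  open import Data.Sum using (inj₁; inj₂)
  open import Data.Vec.Functional using () renaming (_∷_ to _∷ᵛ_)
  open import Relation.Binary.PropositionalEquality as ≡ using (_≡_; _≗_; refl; cong; cong₂; sym; trans; subst; subst₂)
  open import Relation.Nullary using (yes; no; does; ¬_)
  open import Relation.Nullary.Decidable using (does-⇔)
  open import Function.Bundles using (mk⇔)
  open import Defs
  open BigSums
  open Counting
  open Linear

  sublists : ∀ {a} {A : Set a} → List A → List (List A)
  sublists []       = [ [] ]
  sublists (x ∷ xs) = map (x ∷_) (sublists xs) ++ sublists xs

  module _ {a} {A : Set a} where

    sublists-⊆ : ∀ (xs : List A) {T u} → T ∈ sublists xs → u ∈ T → u ∈ xs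
    sublists-⊆ []       (here refl) ()
    sublists-⊆ (x ∷ xs) T∈ u∈ with ∈-++⁻ (map (x ∷_) (sublists xs)) T∈
    ... | inj₂ T∈′ = there (sublists-⊆ xs T∈′ u∈)
    ... | inj₁ xT∈ with ∈-map⁻ (x ∷_) xT∈
    ...   | T , T∈′ , refl with u∈
    ...     | here u≡x  = here u≡x
    ...     | there u∈T = there (sublists-⊆ xs T∈′ u∈T)

    sublists-length : ∀ (xs : List A) {T} → T ∈ sublists xs → length T ≤ length xs
    sublists-length []       (here refl) = z≤n
    sublists-length (x ∷ xs) T∈ with ∈-++⁻ (map (x ∷_) (sublists xs)) T∈
    ... | inj₂ T∈′ = ℕ.m≤n⇒m≤1+n (sublists-length xs T∈′)
    ... | inj₁ xT∈ with ∈-map⁻ (x ∷_) xT∈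
    ...   | T , T∈′ , refl = s≤s (sublists-length xs T∈′)

  maximum-upper : ∀ (xs : List ℕ) {x} → x ∈ xs → x ≤ maximum xs
  maximum-upper (y ∷ xs) (here refl) = ℕ.m≤m⊔n y _
  maximum-upper (y ∷ xs) (there x∈)  = ℕ.≤-trans (maximum-upper xs x∈) (ℕ.m≤n⊔m y _)

  maximum-least : ∀ (xs : List ℕ) {b} → (∀ {x} → x ∈ xs → x ≤ b) → maximum xs ≤ b
  maximum-least []       ≤b = z≤n
  maximum-least (y ∷ xs) ≤b = ℕ.⊔-lub (≤b (here refl)) (maximum-least xs (λ x∈ → ≤b (there x∈)))

  filter-true-map : ∀ {a b} {A : Set a} {B : Set b} (p : B → Bool) (f : A → B) xs →
    filter (λ y → p y Bool.≟ true) (map f xs) ≡ map f (filter (λ x → p (f x) Bool.≟ true) xs)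
  filter-true-map p f []       = refl
  filter-true-map p f (x ∷ xs) with p (f x)
  ... | true  = cong (f x ∷_) (filter-true-map p f xs)
  ... | false = filter-true-map p f xs

  module Rank {c ℓ} (F : FiniteField c ℓ) (N : ℕ) where

    open FiniteField F using (_≈_; 0#; elements; size) renaming (trans to ≈-trans; reflexive to ≈-reflexive)
    open FF F
    open LinearAlgebra F
    open Space N

    step : List V → V → List V
    step acc x with inSpan? acc x
    ... | yes _ = acc
    ... | no  _ = acc ∷ʳ x

    greedy : List V → List V → List V
    greedy acc []       = acc
    greedy acc (x ∷ xs) = greedy (step acc x) xs

    basis : List V → List V
    basis = greedy []

    greedy-∷ʳ : ∀ acc xs x → greedy acc (xs ∷ʳ x) ≡ step (greedy acc xs) x
    greedy-∷ʳ acc []       x = refl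
    greedy-∷ʳ acc (y ∷ xs) x = greedy-∷ʳ (step acc y) xs x

    step-independent : ∀ acc x → Independent acc → Independent (step acc x)
    step-independent acc x indep with inSpan? acc x
    ... | yes _  = indep
    ... | no  x∉ = independent-∷ʳ indep x∉

    greedy-independent : ∀ acc xs → Independent acc → Independent (greedy acc xs)
    greedy-independent acc []       indep = indep
    greedy-independent acc (x ∷ xs) indep = greedy-independent (step acc x) xs (step-independent acc x indep)

    basis-independent : ∀ xs → Independent (basis xs)
    basis-independent xs = greedy-independent [] xs independent-[]

    greedy-extends : ∀ acc xs → ∃ λ T → T ∈ sublists xs × greedy acc xs ≡ acc ++ T
    greedy-extends acc [] = [] , here refl , sym (List.++-identityʳ acc)
    greedy-extends acc (x ∷ xs) with inSpan? acc x
    ... | yes _ with greedy-extends acc xs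
    ...   | T , T∈ , eq = T , ∈-++⁺ʳ (map (x ∷_) (sublists xs)) T∈ , eq
    greedy-extends acc (x ∷ xs) | no _ with greedy-extends (acc ∷ʳ x) xs
    ...   | T , T∈ , eq = x ∷ T , ∈-++⁺ˡ (∈-map⁺ (x ∷_) T∈) , trans eq (List.++-assoc acc [ x ] T)

    step-spans : ∀ acc x → InSpan (step acc x) x
    step-spans acc x with inSpan? acc x
    ... | yes x∈ = x∈
    ... | no  _  = span-∈ (∈-++⁺ʳ acc (here refl))

    greedy-spans : ∀ acc xs → All (InSpan (greedy acc xs)) xs
    greedy-spans acc []       = []
    greedy-spans acc (x ∷ xs) with greedy-extends (step acc x) xs
    ... | T , _ , eq = subst (λ W → InSpan W x) (sym eq) (span-++ʳ (step acc x) T (step-spans acc x))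
                       ∷ greedy-spans (step acc x) xs

    basis-⊆ : ∀ xs {u} → u ∈ basis xs → u ∈ xs
    basis-⊆ xs {u} u∈ with greedy-extends [] xs
    ... | T , T∈ , eq = sublists-⊆ xs T∈ (subst (u ∈_) eq u∈)

    span-basis⇒span : ∀ xs v → InSpan (basis xs) v → InSpan xs v
    span-basis⇒span xs v = span-trans xs (basis xs) (All.tabulate (λ u∈ → span-∈ (basis-⊆ xs u∈)))

    span⇒span-basis : ∀ xs v → InSpan xs v → InSpan (basis xs) v
    span⇒span-basis xs v = span-trans (basis xs) xs (greedy-spans [] xs)

    independent-length-≤ : ∀ xs {T} → Independent T → All (InSpan xs) T → length T ≤ length (basis xs)
    independent-length-≤ xs {T} indep T⊆ = ℕ.≮⇒≥ λ longer → ℕ.<⇒≱ (ℕ.^-monoʳ-< size 2≤size longer) (subst₂ _≤_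
      (count-span T indep) (count-span (basis xs) (basis-independent xs))
      (∑ℕ-mono (allFuns elements N) λ v → 𝟙-does-mono (inSpan? T v) (inSpan? (basis xs) v)
        (λ v∈T → span⇒span-basis xs v (span-trans xs T T⊆ v∈T))))

    score : List V → ℕ
    score T = if isIndependent T then length T else 0

    maximum-score-sublists : ∀ xs → maximum (map score (sublists xs)) ≡ length (basis xs)
    maximum-score-sublists xs = ℕ.≤-antisym (maximum-least _ bounded) attained
      where
      bounded : ∀ {k} → k ∈ map score (sublists xs) → k ≤ length (basis xs)
      bounded k∈ with ∈-map⁻ score k∈
      ... | T , T∈ , refl with isIndependent T in isInd
      ...   | false = z≤n
      ...   | true  = independent-length-≤ xs (isIndependent⇒independent T isInd)
                        (All.tabulate (λ u∈ → span-∈ (sublists-⊆ xs T∈ u∈)))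
      attained : length (basis xs) ≤ maximum (map score (sublists xs))
      attained with greedy-extends [] xs
      ... | T , T∈ , basis≡T = subst (_≤ maximum (map score (sublists xs))) score≡
                                (maximum-upper _ (∈-map⁺ score T∈))
        where
        score≡ : score T ≡ length (basis xs)
        score≡ rewrite sym basis≡T | independent⇒isIndependent (basis xs) (basis-independent xs) = refl

    tailᶜ : ∀ {M} → Matrix N (suc M) → Matrix N M
    tailᶜ A i j = A i (suc j)

    columns : ∀ {M} → Matrix N M → List V
    columns {zero}  A = []
    columns {suc M} A = column A zero ∷ columns (tailᶜ A)

    private
      selectCols-cong : ∀ {M} (A : Matrix N M) {S S′} → S ≗ S′ → selectCols A S ≡ selectCols A S′
      selectCols-cong A S≗S′ = cong (map (column A)) (List.filter-≐ _ _
        ((λ {j} Sj → trans (sym (S≗S′ j)) Sj) , (λ {j} S′j → trans (S≗S′ j) S′j)) (allFin _))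

      selectCols-keep : ∀ {M} (A : Matrix N (suc M)) S →
        selectCols A (true ∷ᵛ S) ≡ column A zero ∷ selectCols (tailᶜ A) S
      selectCols-keep {M} A S = cong (column A zero ∷_)
        (trans (cong (map (column A)) (filter-true-map (true ∷ᵛ S) suc (allFin M))) (sym (List.map-∘ _)))

      selectCols-drop : ∀ {M} (A : Matrix N (suc M)) S →
        selectCols A (false ∷ᵛ S) ≡ selectCols (tailᶜ A) S
      selectCols-drop {M} A S =
        trans (cong (map (column A)) (filter-true-map (false ∷ᵛ S) suc (allFin M))) (sym (List.map-∘ _))

    selections-sublists : ∀ {M} (A : Matrix N M) {b} {B : Set b} (h : List V → B) →
      map (λ S → h (selectCols A S)) (allFuns (true ∷ false ∷ []) M) ≡ map h (sublists (columns A))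
    selections-sublists {zero}  A h = refl
    selections-sublists {suc M} A h = begin
      map (λ S → h (selectCols A S)) (Sels (suc M))
        ≡⟨ map-allFuns-suc (true ∷ false ∷ []) M _ (λ S≗S′ → cong h (selectCols-cong A S≗S′)) ⟩
      map (λ S → h (selectCols A (true ∷ᵛ S))) (Sels M) ++ (map (λ S → h (selectCols A (false ∷ᵛ S))) (Sels M) ++ [])
        ≡⟨ cong₂ _++_ (List.map-cong (λ S → cong h (selectCols-keep A S)) (Sels M))
                      (trans (List.++-identityʳ _) (List.map-cong (λ S → cong h (selectCols-drop A S)) (Sels M))) ⟩
      map (λ S → h (column A zero ∷ selectCols (tailᶜ A) S)) (Sels M) ++ map (λ S → h (selectCols (tailᶜ A) S)) (Sels M)
        ≡⟨ cong₂ _++_ (trans (selections-sublists (tailᶜ A) (λ T → h (column A zero ∷ T))) (List.map-∘ (sublists (columns (tailᶜ A)))))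
                      (selections-sublists (tailᶜ A) h) ⟩
      map h (map (column A zero ∷_) (sublists (columns (tailᶜ A)))) ++ map h (sublists (columns (tailᶜ A)))
        ≡⟨ sym (List.map-++ h (map (column A zero ∷_) (sublists (columns (tailᶜ A)))) _) ⟩
      map h (sublists (columns A)) ∎
      where
      open ≡.≡-Reasoning
      Sels = allFuns (true ∷ false ∷ [])

    rank≡length-basis : ∀ {M} (A : Matrix N M) → rank A ≡ length (basis (columns A))
    rank≡length-basis A = trans (cong maximum (selections-sublists A score)) (maximum-score-sublists (columns A))

    columns-∷ʳᶜ : ∀ {M} (B : Matrix N M) v → columns (B ∷ʳᶜ v) ≡ columns B ∷ʳ v
    columns-∷ʳᶜ {zero}  B v = refl
    columns-∷ʳᶜ {suc M} B v = cong (column B zero ∷_) (columns-∷ʳᶜ (tailᶜ B) v)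

    length-columns : ∀ {M} (A : Matrix N M) → length (columns A) ≡ M
    length-columns {zero}  A = refl
    length-columns {suc M} A = cong suc (length-columns (tailᶜ A))

    rank≤columns : ∀ {M} (A : Matrix N M) → rank A ≤ M
    rank≤columns {M} A with greedy-extends [] (columns A)
    ... | T , T∈ , basis≡T = subst (_≤ M) (sym (trans (rank≡length-basis A) (cong length basis≡T)))
                               (subst (length T ≤_) (length-columns A) (sublists-length (columns A) T∈))

    rank-∷ʳᶜ-∈ : ∀ {M} (B : Matrix N M) v → InSpan (columns B) v → rank (B ∷ʳᶜ v) ≡ rank B
    rank-∷ʳᶜ-∈ B v v∈ = begin
      rank (B ∷ʳᶜ v)                          ≡⟨ rank≡length-basis (B ∷ʳᶜ v) ⟩
      length (basis (columns (B ∷ʳᶜ v)))      ≡⟨ cong (λ L → length (basis L)) (columns-∷ʳᶜ B v) ⟩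
      length (basis (columns B ∷ʳ v))         ≡⟨ cong length (greedy-∷ʳ [] (columns B) v) ⟩
      length (step (basis (columns B)) v)     ≡⟨ cong length (step-∈ (span⇒span-basis (columns B) v v∈)) ⟩
      length (basis (columns B))              ≡⟨ sym (rank≡length-basis B) ⟩
      rank B                                  ∎
      where
      open ≡.≡-Reasoning
      step-∈ : ∀ {acc x} → InSpan acc x → step acc x ≡ acc
      step-∈ {acc} {x} x∈ with inSpan? acc x
      ... | yes _  = refl
      ... | no x∉ = ⊥-elim (x∉ x∈)

    rank-∷ʳᶜ-∉ : ∀ {M} (B : Matrix N M) v → ¬ InSpan (columns B) v → rank (B ∷ʳᶜ v) ≡ suc (rank B)
    rank-∷ʳᶜ-∉ B v v∉ = begin
      rank (B ∷ʳᶜ v)                          ≡⟨ rank≡length-basis (B ∷ʳᶜ v) ⟩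
      length (basis (columns (B ∷ʳᶜ v)))      ≡⟨ cong (λ L → length (basis L)) (columns-∷ʳᶜ B v) ⟩
      length (basis (columns B ∷ʳ v))         ≡⟨ cong length (greedy-∷ʳ [] (columns B) v) ⟩
      length (step (basis (columns B)) v)     ≡⟨ cong length (step-∉ (λ v∈ → v∉ (span-basis⇒span (columns B) v v∈))) ⟩
      length (basis (columns B) ∷ʳ v)         ≡⟨ List.length-++ (basis (columns B)) ⟩
      length (basis (columns B)) Data.Nat.+ 1 ≡⟨ ℕ.+-comm _ 1 ⟩
      suc (length (basis (columns B)))        ≡⟨ cong suc (sym (rank≡length-basis B)) ⟩
      suc (rank B)                            ∎
      where
      open ≡.≡-Reasoning
      step-∉ : ∀ {acc x} → ¬ InSpan acc x → step acc x ≡ acc ∷ʳ x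
      step-∉ {acc} {x} x∉ with inSpan? acc x
      ... | yes x∈ = ⊥-elim (x∉ x∈)
      ... | no _   = refl

    count-column-span : ∀ {M} (B : Matrix N M) →
      ∑ℕ (allFuns elements N) (λ v → 𝟙 (does (inSpan? (columns B) v))) ≡ size ^ rank B
    count-column-span B = begin
      ∑ℕ (allFuns elements N) (λ v → 𝟙 (does (inSpan? (columns B) v)))
        ≡⟨ ∑ℕ-cong (allFuns elements N) (λ v → cong 𝟙 (does-⇔
             (mk⇔ (span⇒span-basis (columns B) v) (span-basis⇒span (columns B) v))
             (inSpan? (columns B) v) (inSpan? (basis (columns B)) v))) ⟩
      ∑ℕ (allFuns elements N) (λ v → 𝟙 (does (inSpan? (basis (columns B)) v)))
        ≡⟨ count-span (basis (columns B)) (basis-independent (columns B)) ⟩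
      size ^ length (basis (columns B))
        ≡⟨ cong (size ^_) (sym (rank≡length-basis B)) ⟩
      size ^ rank B ∎
      where open ≡.≡-Reasoning

    column-span-vanishing : ∀ {M} (B : Matrix N M) {v} i → InSpan (columns B) v → (∀ j → B i j ≈ 0#) → v i ≈ 0#
    column-span-vanishing B i (cs , _ , v≋) Bᵢ≈0 = ≈-trans (v≋ i) (lincomb-vanishing cs (columns B) i (rows B Bᵢ≈0))
      where
      rows : ∀ {M} (B : Matrix N M) → (∀ j → B i j ≈ 0#) → All (λ u → u i ≈ 0#) (columns B)
      rows {zero}  B _     = []
      rows {suc M} B Bᵢ≈0 = Bᵢ≈0 zero ∷ rows (tailᶜ B) (λ j → Bᵢ≈0 (suc j))

    private
      step-cong : ∀ {acc acc′ x x′} → Pointwise _≋_ acc acc′ → x ≋ x′ → Pointwise _≋_ (step acc x) (step acc′ x′)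
      step-cong {acc} {acc′} {x} {x′} acc≋ x≋ with inSpan? acc x | inSpan? acc′ x′
      ... | yes _  | yes _  = acc≋
      ... | no _   | no _   = Pointwise.++⁺ acc≋ (x≋ ∷ [])
      ... | yes x∈ | no x∉  = ⊥-elim (x∉ (InSpan-resp acc≋ x≋ x∈))
      ... | no x∉  | yes x∈ = ⊥-elim (x∉ (InSpan-resp (Pointwise.symmetric ≋-sym acc≋) (≋-sym x≋) x∈))

      greedy-cong : ∀ {acc acc′ xs xs′} → Pointwise _≋_ acc acc′ → Pointwise _≋_ xs xs′ →
        Pointwise _≋_ (greedy acc xs) (greedy acc′ xs′)
      greedy-cong acc≋ []           = acc≋
      greedy-cong acc≋ (x≋ ∷ xs≋) = greedy-cong (step-cong acc≋ x≋) xs≋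

      columns-cong : ∀ {M} {A A′ : Matrix N M} → (∀ i → A i ≗ A′ i) → Pointwise _≋_ (columns A) (columns A′)
      columns-cong {zero}  A≗A′ = []
      columns-cong {suc M} A≗A′ = (λ i → ≈-reflexive (A≗A′ i zero)) ∷ columns-cong (λ i j → A≗A′ i (suc j))

    rank-cong : ∀ {M} {A A′ : Matrix N M} → (∀ i → A i ≗ A′ i) → rank A ≡ rank A′
    rank-cong {A = A} {A′} A≗A′ = begin
      rank A                        ≡⟨ rank≡length-basis A ⟩
      length (basis (columns A))    ≡⟨ Pointwise.Pointwise-length (greedy-cong [] (columns-cong A≗A′)) ⟩
      length (basis (columns A′))   ≡⟨ sym (rank≡length-basis A′) ⟩
      rank A′                       ∎
      where open ≡.≡-Reasoning

module QPochhammer where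

  open import Data.List using ([]; _∷_; _++_; [_]; map; upTo)
  import Data.List.Properties as List
  open import Data.Nat as ℕ using (ℕ; zero; suc; _∸_; _≤_; _<_; s≤s)
  import Data.Nat.Properties as ℕ
  open import Data.Integer using (ℤ; +_; _+_; _-_; _*_; _^_; 1ℤ)
  import Data.Integer.Properties as ℤ
  open import Data.Integer.Tactic.RingSolver using (solve-∀)
  open import Relation.Binary.PropositionalEquality using (_≡_; refl; sym; trans; cong; cong₂; module ≡-Reasoning)
  open import Defs using (prodℤ; poch)
  open ≡-Reasoning

  prodℤ-++ : ∀ xs ys → prodℤ (xs ++ ys) ≡ prodℤ xs * prodℤ ys
  prodℤ-++ []       ys = sym (ℤ.*-identityˡ _)
  prodℤ-++ (x ∷ xs) ys = trans (cong (x *_) (prodℤ-++ xs ys)) (sym (ℤ.*-assoc x _ _))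

  poch-suc : ∀ a q n → poch a q (suc n) ≡ poch a q n * (+ 1 - a * q ^ n)
  poch-suc a q n = begin
    prodℤ (map factor (upTo (suc n)))                ≡⟨ cong (λ is → prodℤ (map factor is)) (sym (List.upTo-∷ʳ n)) ⟩
    prodℤ (map factor (upTo n ++ [ n ]))             ≡⟨ cong prodℤ (List.map-++ factor (upTo n) [ n ]) ⟩
    prodℤ (map factor (upTo n) ++ [ factor n ])      ≡⟨ prodℤ-++ (map factor (upTo n)) [ factor n ] ⟩
    poch a q n * (factor n * 1ℤ)                     ≡⟨ cong (poch a q n *_) (ℤ.*-identityʳ _) ⟩
    poch a q n * factor n                            ∎
    where
    factor : ℕ → ℤ
    factor i = + 1 - a * q ^ i

  module _ (q : ℤ) where

    private
      ∸-suc : ∀ b r → r < b → b ∸ r ≡ suc (b ∸ suc r)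
      ∸-suc (suc b) zero    _       = refl
      ∸-suc (suc b) (suc r) (s≤s r<b) = ∸-suc b r r<b

      q^-split : ∀ r {b} → r < b → q ^ b ≡ q ^ r * q ^ suc (b ∸ suc r)
      q^-split r {b} r<b = begin
        q ^ b                        ≡⟨ cong (q ^_) (sym (ℕ.m+[n∸m]≡n (ℕ.<⇒≤ r<b))) ⟩
        q ^ (r ℕ.+ (b ∸ r))          ≡⟨ cong (λ e → q ^ (r ℕ.+ e)) (∸-suc b r r<b) ⟩
        q ^ (r ℕ.+ suc (b ∸ suc r))  ≡⟨ ℤ.^-distribˡ-+-* q r _ ⟩
        q ^ r * q ^ suc (b ∸ suc r)  ∎

    -- The two ways a new column can change the rank, weighted by their numbers of choices.
    poch-rank-step : ∀ r h b → r < b →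
      q ^ r * poch q q (b ∸ r) + (q ^ h - q ^ r) * poch q q (b ∸ suc r) ≡ (q ^ h - q ^ b) * poch q q (b ∸ 1 ∸ r)
    poch-rank-step r h b r<b = begin
      q ^ r * poch q q (b ∸ r) + (q ^ h - q ^ r) * P
        ≡⟨ cong (λ e → q ^ r * poch q q e + (q ^ h - q ^ r) * P) (∸-suc b r r<b) ⟩
      q ^ r * poch q q (suc n) + (q ^ h - q ^ r) * P
        ≡⟨ cong (λ x → q ^ r * x + (q ^ h - q ^ r) * P) (poch-suc q q n) ⟩
      q ^ r * (P * (+ 1 - q * q ^ n)) + (q ^ h - q ^ r) * P
        ≡⟨ identity (q ^ r) (q ^ suc n) (q ^ h) P ⟩
      (q ^ h - q ^ r * q ^ suc n) * P
        ≡⟨ cong₂ (λ x e → (q ^ h - x) * poch q q e) (sym (q^-split r r<b)) (sym (ℕ.∸-+-assoc b 1 r)) ⟩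
      (q ^ h - q ^ b) * poch q q (b ∸ 1 ∸ r) ∎
      where
      n = b ∸ suc r
      P = poch q q n
      identity : ∀ (A X H Pn : ℤ) → A * (Pn * (+ 1 - X)) + (H - A) * Pn ≡ (H - A * X) * Pn
      identity = solve-∀

    staircaseProduct : (ℕ → ℕ) → ℕ → ℕ → ℤ
    staircaseProduct H zero    b = poch q q b
    staircaseProduct H (suc M) b = (q ^ H M - q ^ b) * staircaseProduct H M (b ∸ 1)

    blockProduct : ℕ → ℕ → ℕ → ℤ
    blockProduct h zero    b = 1ℤ
    blockProduct h (suc t) b = (q ^ h - q ^ b) * blockProduct h t (b ∸ 1)

    staircaseProduct-block : ∀ H X h t b → (∀ u → u < t → H (X ℕ.+ u) ≡ h) →
      staircaseProduct H (X ℕ.+ t) b ≡ blockProduct h t b * staircaseProduct H X (b ∸ t)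
    staircaseProduct-block H X h zero b _ = begin
      staircaseProduct H (X ℕ.+ 0) b   ≡⟨ cong (λ Y → staircaseProduct H Y b) (ℕ.+-identityʳ X) ⟩
      staircaseProduct H X b           ≡⟨ sym (ℤ.*-identityˡ _) ⟩
      1ℤ * staircaseProduct H X b      ∎
    staircaseProduct-block H X h (suc t) b H≡h = begin
      staircaseProduct H (X ℕ.+ suc t) b
        ≡⟨ cong (λ Y → staircaseProduct H Y b) (ℕ.+-suc X t) ⟩
      (q ^ H (X ℕ.+ t) - q ^ b) * staircaseProduct H (X ℕ.+ t) (b ∸ 1)
        ≡⟨ cong₂ (λ e R → (q ^ e - q ^ b) * R) (H≡h t ℕ.≤-refl)
                 (staircaseProduct-block H X h t (b ∸ 1) (λ u u<t → H≡h u (ℕ.m<n⇒m<1+n u<t))) ⟩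
      (q ^ h - q ^ b) * (blockProduct h t (b ∸ 1) * staircaseProduct H X (b ∸ 1 ∸ t))
        ≡⟨ sym (ℤ.*-assoc (q ^ h - q ^ b) _ _) ⟩
      blockProduct h (suc t) b * staircaseProduct H X (b ∸ 1 ∸ t)
        ≡⟨ cong (λ e → blockProduct h (suc t) b * staircaseProduct H X e) (ℕ.∸-+-assoc b 1 t) ⟩
      blockProduct h (suc t) b * staircaseProduct H X (b ∸ suc t) ∎

    -- q^h - q^b = q^h (1 - q^(b-h)): a block of t equal heights shifts a Pochhammer symbol by t.
    blockProduct-poch : ∀ h t b → t ℕ.+ h ≤ b →
      blockProduct h t b * poch q q (b ∸ t ∸ h) ≡ q ^ (h ℕ.* t) * poch q q (b ∸ h)
    blockProduct-poch h zero b _ = begin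
      1ℤ * poch q q (b ∸ h)                  ≡⟨ ℤ.*-identityˡ _ ⟩
      poch q q (b ∸ h)                       ≡⟨ sym (ℤ.*-identityˡ _) ⟩
      1ℤ * poch q q (b ∸ h)                  ≡⟨ cong (λ e → q ^ e * poch q q (b ∸ h)) (sym (ℕ.*-zeroʳ h)) ⟩
      q ^ (h ℕ.* 0) * poch q q (b ∸ h)       ∎
    blockProduct-poch h (suc t) b t+h<b = begin
      (q ^ h - q ^ b) * blockProduct h t (b ∸ 1) * poch q q (b ∸ suc t ∸ h)
        ≡⟨ ℤ.*-assoc (q ^ h - q ^ b) (blockProduct h t (b ∸ 1)) _ ⟩
      (q ^ h - q ^ b) * (blockProduct h t (b ∸ 1) * poch q q (b ∸ suc t ∸ h))
        ≡⟨ cong (λ e → (q ^ h - q ^ b) * (blockProduct h t (b ∸ 1) * poch q q (e ∸ h))) (sym (ℕ.∸-+-assoc b 1 t)) ⟩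
      (q ^ h - q ^ b) * (blockProduct h t (b ∸ 1) * poch q q (b ∸ 1 ∸ t ∸ h))
        ≡⟨ cong ((q ^ h - q ^ b) *_) (trans (blockProduct-poch h t (b ∸ 1) t+h≤b-1)
             (cong (λ e → q ^ (h ℕ.* t) * poch q q e) (ℕ.∸-+-assoc b 1 h))) ⟩
      (q ^ h - q ^ b) * (q ^ (h ℕ.* t) * poch q q n)
        ≡⟨ cong (λ x → (q ^ h - x) * (q ^ (h ℕ.* t) * poch q q n)) (q^-split h h<b) ⟩
      (q ^ h - q ^ h * q ^ suc n) * (q ^ (h ℕ.* t) * poch q q n)
        ≡⟨ identity (q ^ h) (q ^ suc n) (q ^ (h ℕ.* t)) (poch q q n) ⟩
      (q ^ h * q ^ (h ℕ.* t)) * (poch q q n * (+ 1 - q * q ^ n))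
        ≡⟨ cong₂ _*_ (sym (ℤ.^-distribˡ-+-* q h (h ℕ.* t))) (sym (poch-suc q q n)) ⟩
      q ^ (h ℕ.+ h ℕ.* t) * poch q q (suc n)
        ≡⟨ cong₂ (λ e m → q ^ e * poch q q m) (sym (ℕ.*-suc h t)) (sym b∸h) ⟩
      q ^ (h ℕ.* suc t) * poch q q (b ∸ h) ∎
      where
      n = b ∸ suc h
      h<b : h < b
      h<b = ℕ.≤-trans (s≤s (ℕ.m≤n+m h t)) t+h<b
      b∸h : b ∸ h ≡ suc n
      b∸h = ∸-suc b h h<b
      t+h≤b-1 : t ℕ.+ h ≤ b ∸ 1
      t+h≤b-1 = ℕ.≤-trans (ℕ.≤-reflexive (sym (ℕ.m+n∸n≡m (t ℕ.+ h) 1)))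
                          (ℕ.∸-monoˡ-≤ 1 (ℕ.≤-trans (ℕ.≤-reflexive (ℕ.+-comm (t ℕ.+ h) 1)) t+h<b))
      identity : ∀ (H X Hm Pn : ℤ) → (H - H * X) * (Hm * Pn) ≡ (H * Hm) * (Pn * (+ 1 - X))
      identity = solve-∀

module StaircaseMatrices where

  open import Data.Bool using (Bool; true; false; if_then_else_; _∧_; not)
  import Data.Bool.Properties
  open import Data.Empty using (⊥-elim)
  open import Data.Fin using (Fin; zero; suc; toℕ; inject₁; fromℕ)
  import Data.Fin.Properties as Fin
  open import Data.Fin.Relation.Unary.Top using (view; ‵fromℕ; ‵inj₁)
  open import Data.List using (List; []; _∷_)
  open import Data.Nat as ℕ using (ℕ; zero; suc; _≤_; _<_; _∸_; _^_; z≤n; s≤s)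
  import Data.Nat.Properties as ℕ
  open import Data.Integer as ℤ using (ℤ; +_; 0ℤ)
  import Data.Integer.Properties as ℤ
  open import Data.Integer.Tactic.RingSolver using (solve-∀)
  open import Data.Product using (_×_; _,_)
  open import Data.Vec.Functional using (Vector; head; tail)
  open import Function.Bundles using (mk⇔)
  open import Relation.Binary.PropositionalEquality as ≡ using (_≡_; _≗_; refl; cong; cong₂; subst)
  open import Relation.Nullary using (Dec; yes; no; does)
  open import Relation.Nullary.Decidable using (map′; _×-dec_; _→-dec_; does-⇔; dec-true; dec-false)
  open import Defs
  open BigSums
  open Counting
  open Linear
  open Ranks
  open QPochhammer

  open FiniteSums ℤ.+-*-isCommutativeSemiring public using ()
    renaming (∑ to ∑ℤ; ∑-cong to ∑ℤ-cong; ∑-0 to ∑ℤ-0; ∑-+ to ∑ℤ-+; ∑-*ˡ to ∑ℤ-*ˡ; ∑-*ʳ to ∑ℤ-*ʳ;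
              ∑-filter to ∑ℤ-filter; ∑-allFuns-suc to ∑ℤ-allFuns-suc; ∑-allFuns-∷ʳᶜ to ∑ℤ-allFuns-∷ʳᶜ)

  ∑ℤ-pos : ∀ {a} {A : Set a} (xs : List A) (f : A → ℕ) → ∑ℤ xs (λ x → + f x) ≡ + ∑ℕ xs f
  ∑ℤ-pos []       f = refl
  ∑ℤ-pos (x ∷ xs) f = ≡.trans (cong (ℤ._+_ (+ f x)) (∑ℤ-pos xs f)) (≡.sym (ℤ.pos-+ (f x) _))

  ∑ℤ-allFuns-singleton : ∀ {a} {A : Set a} (x : A) n (c : ℤ) → ∑ℤ (allFuns (x ∷ []) n) (λ _ → c) ≡ c
  ∑ℤ-allFuns-singleton x zero    c = ℤ.+-identityʳ c
  ∑ℤ-allFuns-singleton x (suc n) c =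
    ≡.trans (∑ℤ-allFuns-suc (x ∷ []) n (λ _ → c) (λ _ → refl)) (≡.trans (ℤ.+-identityʳ _) (∑ℤ-allFuns-singleton x n c))

  module Staircase {c ℓ} (F : FiniteField c ℓ) where

    open FiniteField F using (Carrier; _≈_; _≟_; 0#; elements; size)
    open FF F
    open LinearAlgebra F

    Supported : ∀ {n} → ℕ → Vector Carrier n → Set ℓ
    Supported h v = ∀ i → h ≤ toℕ i → v i ≈ 0#

    supported? : ∀ {n} h (v : Vector Carrier n) → Dec (Supported h v)
    supported? {zero}  h       v = yes (λ ())
    supported? {suc n} zero    v = map′
      (λ { (v₀≈0 , rest) → λ { zero _ → v₀≈0 ; (suc i) _ → rest i z≤n } })
      (λ sup → sup zero z≤n , λ i _ → sup (suc i) z≤n)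
      (head v ≟ 0# ×-dec supported? 0 (tail v))
    supported? {suc n} (suc h) v = map′
      (λ rest → λ { zero () ; (suc i) (s≤s h≤i) → rest i h≤i })
      (λ sup i h≤i → sup (suc i) (s≤s h≤i))
      (supported? h (tail v))

    supported?-resp : ∀ {n h} {v w : Vector Carrier n} → v ≗ w → does (supported? h v) ≡ does (supported? h w)
    supported?-resp {h = h} {v} {w} v≗w = does-⇔ (mk⇔ (transport v≗w) (transport (λ i → ≡.sym (v≗w i))))
                                                 (supported? h v) (supported? h w)
      where
      transport : ∀ {v w} → v ≗ w → Supported h v → Supported h w
      transport v≗w sup i h≤i = subst (_≈ 0#) (v≗w i) (sup i h≤i)

    count-supported : ∀ {n} h → h ≤ n → ∑ℕ (allFuns elements n) (λ v → 𝟙 (does (supported? h v))) ≡ size ^ h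
    count-supported {zero}  zero    z≤n = refl
    count-supported {suc n} zero    z≤n = begin
      ∑ℕ (allFuns elements (suc n)) (λ v → 𝟙 (does (supported? 0 v)))
        ≡⟨ ∑ℕ-allFuns-suc elements n _ (λ v≗w → cong 𝟙 (supported?-resp {h = 0} v≗w)) ⟩
      ∑ℕ elements (λ x → ∑ℕ (allFuns elements n) (λ f → 𝟙 (does (x ≟ 0#) ∧ does (supported? 0 f))))
        ≡⟨ ∑ℕ-cong elements (λ x → ∑ℕ-cong (allFuns elements n) (λ f → 𝟙-∧ (does (x ≟ 0#)) _)) ⟩
      ∑ℕ elements (λ x → ∑ℕ (allFuns elements n) (λ f → 𝟙 (does (x ≟ 0#)) ℕ.* 𝟙 (does (supported? 0 f))))
        ≡⟨ ∑ℕ-product elements (allFuns elements n) _ _ ⟩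
      ∑ℕ elements (λ x → 𝟙 (does (x ≟ 0#))) ℕ.* ∑ℕ (allFuns elements n) (λ f → 𝟙 (does (supported? 0 f)))
        ≡⟨ cong₂ ℕ._*_ (elements-unique 0#) (count-supported {n} 0 z≤n) ⟩
      1 ∎
      where open ≡.≡-Reasoning
    count-supported {suc n} (suc h) (s≤s h≤n) = begin
      ∑ℕ (allFuns elements (suc n)) (λ v → 𝟙 (does (supported? (suc h) v)))
        ≡⟨ ∑ℕ-allFuns-suc elements n _ (λ v≗w → cong 𝟙 (supported?-resp {h = suc h} v≗w)) ⟩
      ∑ℕ elements (λ _ → ∑ℕ (allFuns elements n) (λ f → 𝟙 (does (supported? h f))))
        ≡⟨ ∑ℕ-const elements _ ⟩
      size ℕ.* ∑ℕ (allFuns elements n) (λ f → 𝟙 (does (supported? h f)))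
        ≡⟨ cong (size ℕ.*_) (count-supported h h≤n) ⟩
      size ^ suc h ∎
      where open ≡.≡-Reasoning

    Staircase : ∀ {N M} → (ℕ → ℕ) → Matrix N M → Set ℓ
    Staircase H A = ∀ i j → H (toℕ j) ≤ toℕ i → A i j ≈ 0#

    staircase? : ∀ {N M} H (A : Matrix N M) → Dec (Staircase H A)
    staircase? H A = Fin.all? λ i → Fin.all? λ j → (H (toℕ j) ℕ.≤? toℕ i) →-dec (A i j ≟ 0#)

    staircase-∷ʳᶜ⇒ : ∀ {N M} H (B : Matrix N M) v → Staircase H (B ∷ʳᶜ v) → Staircase H B × Supported (H M) v
    staircase-∷ʳᶜ⇒ {M = M} H B v st =
      (λ i j H≤i → subst (_≈ 0#) (∷ʳᵛ-inject₁ (B i) (v i) j)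
                     (st i (inject₁ j) (subst (λ s → H s ≤ toℕ i) (≡.sym (Fin.toℕ-inject₁ j)) H≤i))) ,
      (λ i H≤i → subst (_≈ 0#) (∷ʳᵛ-fromℕ (B i) (v i))
                   (st i (fromℕ M) (subst (λ s → H s ≤ toℕ i) (≡.sym (Fin.toℕ-fromℕ M)) H≤i)))

    staircase-∷ʳᶜ⇐ : ∀ {N M} H (B : Matrix N M) v → Staircase H B → Supported (H M) v → Staircase H (B ∷ʳᶜ v)
    staircase-∷ʳᶜ⇐ {M = M} H B v stB supv i j H≤i with view j
    ... | ‵fromℕ  = subst (_≈ 0#) (≡.sym (∷ʳᵛ-fromℕ (B i) (v i)))
                      (supv i (subst (λ s → H s ≤ toℕ i) (Fin.toℕ-fromℕ M) H≤i))
    ... | ‵inj₁ {i = j′} _ = subst (_≈ 0#) (≡.sym (∷ʳᵛ-inject₁ (B i) (v i) j′))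
                      (stB i j′ (subst (λ s → H s ≤ toℕ i) (Fin.toℕ-inject₁ j′) H≤i))

    staircase?-∷ʳᶜ : ∀ {N M} H (B : Matrix N M) v →
      does (staircase? H (B ∷ʳᶜ v)) ≡ does (staircase? H B) ∧ does (supported? (H M) v)
    staircase?-∷ʳᶜ H B v = does-⇔
      (mk⇔ (staircase-∷ʳᶜ⇒ H B v) (λ (stB , supv) → staircase-∷ʳᶜ⇐ H B v stB supv))
      (staircase? H (B ∷ʳᶜ v)) (staircase? H B ×-dec supported? _ v)

    staircase?-cong : ∀ {N M} H {A A′ : Matrix N M} → (∀ i → A i ≗ A′ i) →
      does (staircase? H A) ≡ does (staircase? H A′)
    staircase?-cong H {A} {A′} A≗A′ = does-⇔ (mk⇔ (transport A≗A′) (transport (λ i j → ≡.sym (A≗A′ i j))))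
                                             (staircase? H A) (staircase? H A′)
      where
      transport : ∀ {A A′ : Matrix _ _} → (∀ i → A i ≗ A′ i) → Staircase H A → Staircase H A′
      transport A≗A′ st i j H≤i = subst (_≈ 0#) (A≗A′ i j) (st i j H≤i)

    private
      +-^ : ∀ a n → (+ a) ℤ.^ n ≡ + (a ^ n)
      +-^ a zero    = refl
      +-^ a (suc n) = ≡.trans (cong (+ a ℤ.*_) (+-^ a n)) (≡.sym (ℤ.pos-* a (a ^ n)))

    module _ (N : ℕ) where

      open Space N
      open Rank F N

      private
        split-by-span : ∀ {M} (B : Matrix N M) h b v →
          (if does (supported? h v) then poch q q (b ∸ rank (B ∷ʳᶜ v)) else 0ℤ)
            ≡ + 𝟙 (does (supported? h v) ∧ does (inSpan? (columns B) v)) ℤ.* poch q q (b ∸ rank B)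
              ℤ.+ + 𝟙 (does (supported? h v) ∧ not (does (inSpan? (columns B) v))) ℤ.* poch q q (b ∸ suc (rank B))
        split-by-span B h b v with supported? h v | inSpan? (columns B) v
        ... | yes _ | yes v∈ = ≡.trans (cong (λ r → poch q q (b ∸ r)) (rank-∷ʳᶜ-∈ B v v∈)) (lhs-only _ (poch q q (b ∸ suc (rank B))))
          where
          lhs-only : ∀ x y → x ≡ + 1 ℤ.* x ℤ.+ + 0 ℤ.* y
          lhs-only = solve-∀
        ... | yes _ | no v∉  = ≡.trans (cong (λ r → poch q q (b ∸ r)) (rank-∷ʳᶜ-∉ B v v∉)) (rhs-only (poch q q (b ∸ rank B)) _)
          where
          rhs-only : ∀ x y → y ≡ + 0 ℤ.* x ℤ.+ + 1 ℤ.* y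
          rhs-only = solve-∀
        ... | no _  | _      = neither (poch q q (b ∸ rank B)) (poch q q (b ∸ suc (rank B)))
          where
          neither : ∀ x y → 0ℤ ≡ + 0 ℤ.* x ℤ.+ + 0 ℤ.* y
          neither = solve-∀

      module _ {M} (H : ℕ → ℕ) (B : Matrix N M) (stB : Staircase H B) (h≤N : H M ≤ N)
               (H≤h : ∀ s → s < M → H s ≤ H M) where

        private
          Vs = allFuns elements N
          h = H M
          supp span : Vector Carrier N → Bool
          supp v = does (supported? h v)
          span v = does (inSpan? (columns B) v)

        column-span⊆supported : ∀ {v} → InSpan (columns B) v → Supported h v
        column-span⊆supported v∈ i h≤i = column-span-vanishing B i v∈ λ j →
          stB i j (ℕ.≤-trans (H≤h (toℕ j) (Fin.toℕ<n j)) h≤i)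

        count-supported-in-span : ∑ℕ Vs (λ v → 𝟙 (supp v ∧ span v)) ≡ size ^ rank B
        count-supported-in-span = ≡.trans (∑ℕ-cong Vs in-span) (count-column-span B)
          where
          in-span : ∀ v → 𝟙 (supp v ∧ span v) ≡ 𝟙 (span v)
          in-span v with supported? h v | inSpan? (columns B) v
          ... | _     | no _   = cong 𝟙 (Data.Bool.Properties.∧-zeroʳ _)
          ... | yes _ | yes _  = refl
          ... | no v∉ | yes v∈ = ⊥-elim (v∉ (column-span⊆supported v∈))

        count-supported-outside-span : + ∑ℕ Vs (λ v → 𝟙 (supp v ∧ not (span v))) ≡ q ℤ.^ h ℤ.- q ℤ.^ rank B
        count-supported-outside-span = begin
          + #out                           ≡⟨ ≡.sym (cancel (+ #in) (+ #out)) ⟩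
          (+ #in ℤ.+ + #out) ℤ.- + #in     ≡⟨ cong₂ ℤ._-_ (≡.trans (≡.sym (ℤ.pos-+ #in #out)) (cong +_ #in+#out))
                                                           (cong +_ count-supported-in-span) ⟩
          + (size ^ h) ℤ.- + (size ^ rank B) ≡⟨ cong₂ ℤ._-_ (≡.sym (+-^ size h)) (≡.sym (+-^ size (rank B))) ⟩
          q ℤ.^ h ℤ.- q ℤ.^ rank B         ∎
          where
          open ≡.≡-Reasoning
          #in = ∑ℕ Vs (λ v → 𝟙 (supp v ∧ span v))
          #out = ∑ℕ Vs (λ v → 𝟙 (supp v ∧ not (span v)))
          cancel : ∀ x y → (x ℤ.+ y) ℤ.- x ≡ y
          cancel = solve-∀
          #in+#out : #in ℕ.+ #out ≡ size ^ h
          #in+#out = ≡.trans (≡.sym (∑ℕ-+ Vs _ _))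
                       (≡.trans (∑ℕ-cong Vs (λ v → 𝟙-split (supp v) (span v))) (count-supported h h≤N))

        new-column-sum : ∀ b → rank B < b →
          ∑ℤ Vs (λ v → if supp v then poch q q (b ∸ rank (B ∷ʳᶜ v)) else 0ℤ)
            ≡ (q ℤ.^ h ℤ.- q ℤ.^ b) ℤ.* poch q q (b ∸ 1 ∸ rank B)
        new-column-sum b r<b = begin
          ∑ℤ Vs (λ v → if supp v then poch q q (b ∸ rank (B ∷ʳᶜ v)) else 0ℤ)
            ≡⟨ ∑ℤ-cong Vs (split-by-span B h b) ⟩
          ∑ℤ Vs (λ v → + 𝟙 (supp v ∧ span v) ℤ.* P₀ ℤ.+ + 𝟙 (supp v ∧ not (span v)) ℤ.* P₁)
            ≡⟨ ∑ℤ-+ Vs _ _ ⟩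
          ∑ℤ Vs (λ v → + 𝟙 (supp v ∧ span v) ℤ.* P₀) ℤ.+ ∑ℤ Vs (λ v → + 𝟙 (supp v ∧ not (span v)) ℤ.* P₁)
            ≡⟨ cong₂ ℤ._+_ (≡.trans (∑ℤ-*ʳ Vs P₀ _) (cong (ℤ._* P₀) (∑ℤ-pos Vs _)))
                           (≡.trans (∑ℤ-*ʳ Vs P₁ _) (cong (ℤ._* P₁) (∑ℤ-pos Vs _))) ⟩
          + ∑ℕ Vs (λ v → 𝟙 (supp v ∧ span v)) ℤ.* P₀ ℤ.+ + ∑ℕ Vs (λ v → 𝟙 (supp v ∧ not (span v))) ℤ.* P₁
            ≡⟨ cong₂ (λ x y → x ℤ.* P₀ ℤ.+ y ℤ.* P₁)
                     (≡.trans (cong +_ count-supported-in-span) (≡.sym (+-^ size (rank B))))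
                     count-supported-outside-span ⟩
          q ℤ.^ rank B ℤ.* P₀ ℤ.+ (q ℤ.^ h ℤ.- q ℤ.^ rank B) ℤ.* P₁
            ≡⟨ poch-rank-step q (rank B) h b r<b ⟩
          (q ℤ.^ h ℤ.- q ℤ.^ b) ℤ.* poch q q (b ∸ 1 ∸ rank B) ∎
          where
          open ≡.≡-Reasoning
          P₀ = poch q q (b ∸ rank B)
          P₁ = poch q q (b ∸ suc (rank B))

      weight : ∀ {M} → (ℕ → ℕ) → ℕ → Matrix N M → ℤ
      weight H b A = if does (staircase? H A) then poch q q (b ∸ rank A) else 0ℤ

      private
        weight-cong : ∀ {M} H b {A A′ : Matrix N M} → (∀ i → A i ≗ A′ i) → weight H b A ≡ weight H b A′
        weight-cong H b A≗A′ =
          cong₂ (λ t r → if t then poch q q (b ∸ r) else 0ℤ) (staircase?-cong H A≗A′) (rank-cong A≗A′)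

        weight-∷ʳᶜ : ∀ {M} H b (B : Matrix N M) → rank B < b → H M ≤ N → (∀ s → s < M → H s ≤ H M) →
          ∑ℤ (allFuns elements N) (λ v → weight H b (B ∷ʳᶜ v)) ≡ (q ℤ.^ H M ℤ.- q ℤ.^ b) ℤ.* weight H (b ∸ 1) B
        weight-∷ʳᶜ {M} H b B r<b h≤N H≤h with staircase? H B
        ... | yes stB = begin
          ∑ℤ (allFuns elements N) (λ v → weight H b (B ∷ʳᶜ v))
            ≡⟨ ∑ℤ-cong (allFuns elements N) (λ v → cong (λ t → if t then poch q q (b ∸ rank (B ∷ʳᶜ v)) else 0ℤ)
                 (≡.trans (staircase?-∷ʳᶜ H B v) (cong (_∧ does (supported? (H M) v)) (dec-true (staircase? H B) stB)))) ⟩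
          ∑ℤ (allFuns elements N) (λ v → if does (supported? (H M) v) then poch q q (b ∸ rank (B ∷ʳᶜ v)) else 0ℤ)
            ≡⟨ new-column-sum H B stB h≤N H≤h b r<b ⟩
          (q ℤ.^ H M ℤ.- q ℤ.^ b) ℤ.* poch q q (b ∸ 1 ∸ rank B)
            ≡⟨ cong (λ t → (q ℤ.^ H M ℤ.- q ℤ.^ b) ℤ.* (if t then poch q q (b ∸ 1 ∸ rank B) else 0ℤ))
                 (≡.sym (dec-true (staircase? H B) stB)) ⟩
          (q ℤ.^ H M ℤ.- q ℤ.^ b) ℤ.* weight H (b ∸ 1) B ∎
          where open ≡.≡-Reasoning
        ... | no ¬stB = begin
          ∑ℤ (allFuns elements N) (λ v → weight H b (B ∷ʳᶜ v))
            ≡⟨ ∑ℤ-cong (allFuns elements N) (λ v → cong (λ t → if t then poch q q (b ∸ rank (B ∷ʳᶜ v)) else 0ℤ)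
                 (≡.trans (staircase?-∷ʳᶜ H B v) (cong (_∧ does (supported? (H M) v)) (dec-false (staircase? H B) ¬stB)))) ⟩
          ∑ℤ (allFuns elements N) (λ _ → 0ℤ)
            ≡⟨ ∑ℤ-0 (allFuns elements N) ⟩
          0ℤ
            ≡⟨ ≡.sym (ℤ.*-zeroʳ (q ℤ.^ H M ℤ.- q ℤ.^ b)) ⟩
          (q ℤ.^ H M ℤ.- q ℤ.^ b) ℤ.* 0ℤ
            ≡⟨ cong (λ t → (q ℤ.^ H M ℤ.- q ℤ.^ b) ℤ.* (if t then poch q q (b ∸ 1 ∸ rank B) else 0ℤ))
                 (≡.sym (dec-false (staircase? H B) ¬stB)) ⟩
          (q ℤ.^ H M ℤ.- q ℤ.^ b) ℤ.* weight H (b ∸ 1) B ∎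
          where open ≡.≡-Reasoning

      staircase-sum : ∀ M H b → (∀ s → s < M → H s ≤ N) → (∀ s s′ → s ≤ s′ → s′ < M → H s ≤ H s′) → M ≤ b →
        ∑ℤ (allFuns (allFuns elements M) N) (weight H b) ≡ staircaseProduct q H M b
      staircase-sum zero H b _ _ _ = ≡.trans (∑ℤ-cong (allFuns (allFuns elements 0) N) empty-weight)
                                             (∑ℤ-allFuns-singleton _ N (poch q q b))
        where
        empty-weight : ∀ (A : Matrix N 0) → weight H b A ≡ poch q q b
        empty-weight A = cong₂ (λ t r → if t then poch q q (b ∸ r) else 0ℤ)
          (dec-true (staircase? H A) (λ _ ()))
          (ℕ.n≤0⇒n≡0 (rank≤columns A))
      staircase-sum (suc M) H b H≤N H-mono M<b = begin
        ∑ℤ (allFuns (allFuns elements (suc M)) N) (weight H b)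
          ≡⟨ ∑ℤ-allFuns-∷ʳᶜ elements N M (weight H b) (weight-cong H b) ⟩
        ∑ℤ (allFuns (allFuns elements M) N) (λ B → ∑ℤ (allFuns elements N) (λ v → weight H b (B ∷ʳᶜ v)))
          ≡⟨ ∑ℤ-cong (allFuns (allFuns elements M) N) (λ B → weight-∷ʳᶜ H b B
               (ℕ.<-≤-trans (s≤s (rank≤columns B)) M<b) (H≤N M ℕ.≤-refl) (λ s s<M → H-mono s M (ℕ.<⇒≤ s<M) ℕ.≤-refl)) ⟩
        ∑ℤ (allFuns (allFuns elements M) N) (λ B → (q ℤ.^ H M ℤ.- q ℤ.^ b) ℤ.* weight H (b ∸ 1) B)
          ≡⟨ ∑ℤ-*ˡ (allFuns (allFuns elements M) N) (q ℤ.^ H M ℤ.- q ℤ.^ b) (weight H (b ∸ 1)) ⟩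
        (q ℤ.^ H M ℤ.- q ℤ.^ b) ℤ.* ∑ℤ (allFuns (allFuns elements M) N) (weight H (b ∸ 1))
          ≡⟨ cong ((q ℤ.^ H M ℤ.- q ℤ.^ b) ℤ.*_)
               (staircase-sum M H (b ∸ 1) (λ s s<M → H≤N s (ℕ.m<n⇒m<1+n s<M))
                 (λ s s′ s≤s′ s′<M → H-mono s s′ s≤s′ (ℕ.m<n⇒m<1+n s′<M)) (ℕ.∸-monoˡ-≤ 1 M<b)) ⟩
        staircaseProduct q H (suc M) b ∎
        where open ≡.≡-Reasoning

module BlockIndices where

  open import Data.Bool using (true; false)
  open import Data.Empty using (⊥-elim)
  open import Data.Sum using (inj₁; inj₂)
  open import Data.List using (List; []; _∷_; map; upTo)
  import Data.List.Properties as List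
  open import Data.Nat using (ℕ; zero; suc; _+_; _*_; _∸_; _≤_; _<_; _≤?_; z≤n; s≤s)
  open import Data.Nat.Properties
  open import Relation.Binary.PropositionalEquality using (_≡_; refl; sym; trans; cong; cong₂; subst; subst₂; module ≡-Reasoning)
  open import Relation.Nullary using (yes; no; ¬_)
  open import Relation.Nullary.Decidable using (⌊_⌋)
  open import Function.Bundles using (_⇔_; mk⇔)
  open import Defs using (sumFT; range)
  open Counting

  private
    ∑-upTo : (ℕ → ℕ) → ℕ → ℕ
    ∑-upTo g n = ∑ℕ (upTo n) g

    ∑-upTo-suc : ∀ g n → ∑-upTo g (suc n) ≡ ∑-upTo g n + g n
    ∑-upTo-suc g n = trans (cong (λ l → ∑ℕ l g) (sym (List.upTo-∷ʳ n)))
      (trans (∑ℕ-++ (upTo n) (n ∷ []) g) (cong (∑-upTo g n +_) (+-identityʳ (g n))))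

    ∑-upTo-shift : ∀ g n → ∑-upTo g (suc n) ≡ g 0 + ∑-upTo (λ t → g (suc t)) n
    ∑-upTo-shift g n = cong (g 0 +_) (trans (cong (λ l → ∑ℕ l g) (sym (List.map-upTo suc n))) (∑ℕ-map suc (upTo n) g))

    ∑-upTo-cong : ∀ n {f g} → (∀ t → t < n → f t ≡ g t) → ∑-upTo f n ≡ ∑-upTo g n
    ∑-upTo-cong zero    f≡g = refl
    ∑-upTo-cong (suc n) {f} {g} f≡g = trans (∑-upTo-suc f n)
      (trans (cong₂ _+_ (∑-upTo-cong n (λ t t<n → f≡g t (m<n⇒m<1+n t<n))) (f≡g n ≤-refl)) (sym (∑-upTo-suc g n)))

    ∑-upTo-mono : ∀ n {f g} → (∀ t → t < n → f t ≤ g t) → ∑-upTo f n ≤ ∑-upTo g n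
    ∑-upTo-mono zero    f≤g = z≤n
    ∑-upTo-mono (suc n) {f} {g} f≤g = subst₂ _≤_ (sym (∑-upTo-suc f n)) (sym (∑-upTo-suc g n))
      (+-mono-≤ (∑-upTo-mono n (λ t t<n → f≤g t (m<n⇒m<1+n t<n))) (f≤g n ≤-refl))

    sumFT-upTo : ∀ lo hi g → sumFT lo hi g ≡ ∑-upTo (λ t → g (lo + t)) (suc hi ∸ lo)
    sumFT-upTo lo hi g = ∑ℕ-map (lo +_) (upTo (suc hi ∸ lo)) g

    in-range : ∀ lo hi t → t < suc hi ∸ lo → lo + t ≤ hi
    in-range lo hi t t<len with lo ≤? suc hi
    ... | yes lo≤ = ≤-pred (subst₂ _≤_ (+-suc lo t) (m+[n∸m]≡n lo≤) (+-monoʳ-≤ lo t<len))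
    ... | no lo≰ with () ← subst (suc t ≤_) (m≤n⇒m∸n≡0 (<⇒≤ (≰⇒> lo≰))) t<len

  sumFT-cong : ∀ lo hi {f g} → (∀ i → lo ≤ i → i ≤ hi → f i ≡ g i) → sumFT lo hi f ≡ sumFT lo hi g
  sumFT-cong lo hi {f} {g} f≡g = trans (sumFT-upTo lo hi f) (trans
    (∑-upTo-cong (suc hi ∸ lo) (λ t t<len → f≡g (lo + t) (m≤m+n lo t) (in-range lo hi t t<len)))
    (sym (sumFT-upTo lo hi g)))

  sumFT-mono : ∀ lo hi {f g} → (∀ i → lo ≤ i → i ≤ hi → f i ≤ g i) → sumFT lo hi f ≤ sumFT lo hi g
  sumFT-mono lo hi {f} {g} f≤g = subst₂ _≤_ (sym (sumFT-upTo lo hi f)) (sym (sumFT-upTo lo hi g))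
    (∑-upTo-mono (suc hi ∸ lo) (λ t t<len → f≤g (lo + t) (m≤m+n lo t) (in-range lo hi t t<len)))

  sumFT-snoc : ∀ lo hi g → lo ≤ suc hi → sumFT lo (suc hi) g ≡ sumFT lo hi g + g (suc hi)
  sumFT-snoc lo hi g lo≤ = trans (sumFT-upTo lo (suc hi) g)
    (trans (cong (∑-upTo (λ t → g (lo + t))) (+-∸-assoc 1 lo≤))
    (trans (∑-upTo-suc _ (suc hi ∸ lo)) (cong₂ _+_ (sym (sumFT-upTo lo hi g)) (cong g (m+[n∸m]≡n lo≤)))))

  sumFT-cons : ∀ lo hi g → lo ≤ hi → sumFT lo hi g ≡ g lo + sumFT (suc lo) hi g
  sumFT-cons lo hi g lo≤ = trans (sumFT-upTo lo hi g)
    (trans (cong (∑-upTo (λ t → g (lo + t))) (+-∸-assoc 1 lo≤))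
    (trans (∑-upTo-shift _ (hi ∸ lo)) (cong₂ _+_ (cong g (+-identityʳ lo))
       (trans (∑-upTo-cong (hi ∸ lo) (λ t _ → cong g (+-suc lo t))) (sym (sumFT-upTo (suc lo) hi g))))))

  sumFT-empty : ∀ lo hi g → hi < lo → sumFT lo hi g ≡ 0
  sumFT-empty lo hi g hi<lo = trans (sumFT-upTo lo hi g) (cong (∑-upTo (λ t → g (lo + t))) (m≤n⇒m∸n≡0 hi<lo))

  sumFT-split : ∀ lo mid hi g → lo ≤ suc mid → mid ≤ hi → sumFT lo hi g ≡ sumFT lo mid g + sumFT (suc mid) hi g
  sumFT-split lo mid hi g lo≤ mid≤hi with m≤n⇒m<n∨m≡n mid≤hi
  ... | inj₂ refl = sym (trans (cong (sumFT lo mid g +_) (sumFT-empty (suc mid) mid g ≤-refl)) (+-identityʳ _))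
  sumFT-split lo mid (suc hi) g lo≤ mid≤hi | inj₁ (s≤s mid≤hi′) = begin
    sumFT lo (suc hi) g                                  ≡⟨ sumFT-snoc lo hi g (≤-trans lo≤ (s≤s mid≤hi′)) ⟩
    sumFT lo hi g + g (suc hi)                           ≡⟨ cong (_+ g (suc hi)) (sumFT-split lo mid hi g lo≤ mid≤hi′) ⟩
    sumFT lo mid g + sumFT (suc mid) hi g + g (suc hi)   ≡⟨ +-assoc (sumFT lo mid g) _ _ ⟩
    sumFT lo mid g + (sumFT (suc mid) hi g + g (suc hi)) ≡⟨ cong (sumFT lo mid g +_) (sym (sumFT-snoc (suc mid) hi g (s≤s mid≤hi′))) ⟩
    sumFT lo mid g + sumFT (suc mid) (suc hi) g          ∎
    where
    open ≡-Reasoning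

  sumFT-+ : ∀ lo hi (f g : ℕ → ℕ) → sumFT lo hi (λ i → f i + g i) ≡ sumFT lo hi f + sumFT lo hi g
  sumFT-+ lo hi f g = ∑ℕ-+ (range lo hi) f g

  sumFT-const : ∀ j c → sumFT 1 j (λ _ → c) ≡ j * c
  sumFT-const j c = trans (∑ℕ-const (range 1 j) c) (cong (_* c) (trans (List.length-map _ (upTo j)) (List.length-upTo j)))

  sumFT-0 : ∀ lo hi → sumFT lo hi (λ _ → 0) ≡ 0
  sumFT-0 lo hi = ∑ℕ-0 (range lo hi)

  prefix-mono : ∀ (g : ℕ → ℕ) {i j} → i ≤ j → sumFT 1 i g ≤ sumFT 1 j g
  prefix-mono g {i} {j} i≤j = subst (sumFT 1 i g ≤_) (sym (sumFT-split 1 i j g (s≤s z≤n) i≤j)) (m≤m+n _ _)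

  block : (ℕ → ℕ) → ℕ → ℕ → ℕ
  block g k x = suc (sumFT 1 k (λ i → 𝟙 ⌊ sumFT 1 i g ≤? x ⌋))

  private
    𝟙≤1 : ∀ b → 𝟙 b ≤ 1
    𝟙≤1 true  = ≤-refl
    𝟙≤1 false = z≤n

    𝟙-≤?-mono : ∀ a {x y} → x ≤ y → 𝟙 ⌊ a ≤? x ⌋ ≤ 𝟙 ⌊ a ≤? y ⌋
    𝟙-≤?-mono a {x} {y} x≤y with a ≤? x | a ≤? y
    ... | no _    | _       = z≤n
    ... | yes _   | yes _   = ≤-refl
    ... | yes a≤x | no a≰y  = ⊥-elim (a≰y (≤-trans a≤x x≤y))

    𝟙-≤?-true : ∀ {a x} → a ≤ x → 𝟙 ⌊ a ≤? x ⌋ ≡ 1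
    𝟙-≤?-true {a} {x} a≤x with a ≤? x
    ... | yes _   = refl
    ... | no a≰x  = ⊥-elim (a≰x a≤x)

    𝟙-≤?-false : ∀ {a x} → ¬ a ≤ x → 𝟙 ⌊ a ≤? x ⌋ ≡ 0
    𝟙-≤?-false {a} {x} a≰x with a ≤? x
    ... | yes a≤x = ⊥-elim (a≰x a≤x)
    ... | no _    = refl

  block≤ : ∀ g k j x → 1 ≤ j → j ≤ k → x < sumFT 1 j g → block g k x ≤ j
  block≤ g k (suc j) x _ j<k x<Sⱼ = s≤s (begin
    sumFT 1 k F                    ≡⟨ sumFT-split 1 j k F (s≤s z≤n) (≤-trans (n≤1+n j) j<k) ⟩
    sumFT 1 j F + sumFT (suc j) k F ≡⟨ cong (sumFT 1 j F +_) later-blocks ⟩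
    sumFT 1 j F + 0                ≡⟨ +-identityʳ _ ⟩
    sumFT 1 j F                    ≤⟨ sumFT-mono 1 j (λ i _ _ → 𝟙≤1 ⌊ sumFT 1 i g ≤? x ⌋) ⟩
    sumFT 1 j (λ _ → 1)            ≡⟨ trans (sumFT-const j 1) (*-identityʳ j) ⟩
    j                              ∎)
    where
    open ≤-Reasoning
    F : ℕ → ℕ
    F i = 𝟙 ⌊ sumFT 1 i g ≤? x ⌋
    later-blocks : sumFT (suc j) k F ≡ 0
    later-blocks = trans (sumFT-cong (suc j) k (λ i j<i _ → 𝟙-≤?-false λ Sᵢ≤x → <⇒≱ x<Sⱼ (≤-trans (prefix-mono g j<i) Sᵢ≤x)))
                         (sumFT-0 (suc j) k)

  block> : ∀ g k j x → j ≤ k → sumFT 1 j g ≤ x → suc j ≤ block g k x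
  block> g k j x j≤k Sⱼ≤x = s≤s (begin
    j                                ≡⟨ sym (trans (sumFT-const j 1) (*-identityʳ j)) ⟩
    sumFT 1 j (λ _ → 1)              ≡⟨ sumFT-cong 1 j (λ i _ i≤j → sym (𝟙-≤?-true (≤-trans (prefix-mono g i≤j) Sⱼ≤x))) ⟩
    sumFT 1 j F                      ≤⟨ m≤m+n _ _ ⟩
    sumFT 1 j F + sumFT (suc j) k F  ≡⟨ sym (sumFT-split 1 j k F (s≤s z≤n) j≤k) ⟩
    sumFT 1 k F                      ∎)
    where
    open ≤-Reasoning
    F : ℕ → ℕ
    F i = 𝟙 ⌊ sumFT 1 i g ≤? x ⌋

  block-mono : ∀ g k {x y} → x ≤ y → block g k x ≤ block g k y
  block-mono g k x≤y = s≤s (sumFT-mono 1 k (λ i _ _ → 𝟙-≤?-mono (sumFT 1 i g) x≤y))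

  block≤k : ∀ g k x → 1 ≤ k → x < sumFT 1 k g → block g k x ≤ k
  block≤k g k x 1≤k x<S = block≤ g k k x 1≤k ≤-refl x<S

  block-of-offset : ∀ g k j u → suc j ≤ k → u < g (suc j) → block g k (sumFT 1 j g + u) ≡ suc j
  block-of-offset g k j u j<k u<gⱼ = ≤-antisym
    (block≤ g k (suc j) _ (s≤s z≤n) j<k
      (subst (sumFT 1 j g + u <_) (sym (sumFT-snoc 1 j g (s≤s z≤n))) (+-monoʳ-< (sumFT 1 j g) u<gⱼ)))
    (lower j j<k)
    where
    lower : ∀ j → suc j ≤ k → suc j ≤ block g k (sumFT 1 j g + u)
    lower zero    _   = s≤s z≤n
    lower (suc j) j<k = block> g k (suc j) _ (≤-trans (n≤1+n _) j<k) (m≤m+n _ u)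

  block<block⇔ : ∀ μ ν k s r → 1 ≤ k → s < sumFT 1 k μ →
    (block μ k s < block ν k r) ⇔ (sumFT 1 (block μ k s) ν ≤ r)
  block<block⇔ μ ν k s r 1≤k s<S = mk⇔
    (λ j<blockᵣ → ≮⇒≥ λ r<Sⱼ → <⇒≱ j<blockᵣ (block≤ ν k (block μ k s) r (s≤s z≤n) j≤k r<Sⱼ))
    (λ Sⱼ≤r → block> ν k (block μ k s) r j≤k Sⱼ≤r)
    where
    j≤k = block≤k μ k s 1≤k s<S

module BlockProducts where

  open import Data.List using (List; _∷_; map; upTo)
  import Data.List.Properties as List
  open import Data.Nat as ℕ using (ℕ; zero; suc; _∸_; _≤_; _<_; z≤n; s≤s)
  import Data.Nat.Properties as ℕ
  open import Data.Integer using (ℤ; _*_; _^_; 1ℤ)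
  import Data.Integer.Properties as ℤ
  open import Data.Integer.Tactic.RingSolver using (solve-∀)
  open import Relation.Binary.PropositionalEquality using (_≡_; refl; sym; trans; cong; cong₂; module ≡-Reasoning)
  open import Defs using (prodℤ; poch; sumFT; range)
  open Counting
  open QPochhammer
  open BlockIndices

  ∏ : (ℕ → ℤ) → ℕ → ℤ
  ∏ f zero    = 1ℤ
  ∏ f (suc j) = ∏ f j * f (suc j)

  ∏-cong : ∀ {f g : ℕ → ℤ} k → (∀ i → 1 ≤ i → i ≤ k → f i ≡ g i) → ∏ f k ≡ ∏ g k
  ∏-cong zero    f≡g = refl
  ∏-cong (suc k) f≡g = cong₂ _*_ (∏-cong k (λ i 1≤i i≤k → f≡g i 1≤i (ℕ.m≤n⇒m≤1+n i≤k))) (f≡g (suc k) (s≤s z≤n) ℕ.≤-refl)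

  prodℤ-range-1 : ∀ (f : ℕ → ℤ) k → prodℤ (map f (range 1 k)) ≡ ∏ f k
  prodℤ-range-1 f zero    = refl
  prodℤ-range-1 f (suc k) = begin
    prodℤ (map f (map (1 ℕ.+_) (upTo (suc k))))          ≡⟨ cong (λ l → prodℤ (map f (map (1 ℕ.+_) l))) (sym (List.upTo-∷ʳ k)) ⟩
    prodℤ (map f (map (1 ℕ.+_) (upTo k Data.List.++ [ k ])))
      ≡⟨ cong (λ l → prodℤ (map f l)) (List.map-++ (1 ℕ.+_) (upTo k) [ k ]) ⟩
    prodℤ (map f (range 1 k Data.List.++ [ suc k ]))       ≡⟨ cong prodℤ (List.map-++ f (range 1 k) [ suc k ]) ⟩
    prodℤ (map f (range 1 k) Data.List.++ [ f (suc k) ])   ≡⟨ prodℤ-++ (map f (range 1 k)) [ f (suc k) ] ⟩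
    prodℤ (map f (range 1 k)) * (f (suc k) * 1ℤ)           ≡⟨ cong₂ _*_ (prodℤ-range-1 f k) (ℤ.*-identityʳ (f (suc k))) ⟩
    ∏ f (suc k)                                            ∎
    where
    open ≡-Reasoning
    open Data.List using ([_])

  prodℤ-range-0 : ∀ (f : ℕ → ℤ) k → prodℤ (map f (range 0 k)) ≡ f 0 * ∏ f k
  prodℤ-range-0 f k = cong (f 0 *_) (trans (cong (λ l → prodℤ (map f l))
    (trans (List.map-applyUpTo suc (0 ℕ.+_) k) (sym (List.map-upTo (1 ℕ.+_) k)))) (prodℤ-range-1 f k))

  ∏-reverse : ∀ (g : ℕ → ℤ) k → ∏ (λ i → g (k ∸ i ℕ.+ 1)) k ≡ ∏ g k
  ∏-reverse g zero    = refl
  ∏-reverse g (suc k) = begin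
    ∏ (λ i → g (suc k ∸ i ℕ.+ 1)) k * g (suc k ∸ suc k ℕ.+ 1)
      ≡⟨ cong₂ _*_ (trans (∏-cong k (λ i _ i≤k → cong (λ z → g (z ℕ.+ 1)) (ℕ.+-∸-assoc 1 i≤k)))
                          (∏-reverse (λ i → g (suc i)) k))
                   (cong (λ z → g (z ℕ.+ 1)) (ℕ.n∸n≡0 k)) ⟩
    ∏ (λ i → g (suc i)) k * g 1
      ≡⟨ ℤ.*-comm _ (g 1) ⟩
    g 1 * ∏ (λ i → g (suc i)) k
      ≡⟨ sym (∏-shiftˡ g k) ⟩
    ∏ g (suc k) ∎
    where
    open ≡-Reasoning
    ∏-shiftˡ : ∀ (g : ℕ → ℤ) k → ∏ g (suc k) ≡ g 1 * ∏ (λ i → g (suc i)) k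
    ∏-shiftˡ g zero    = trans (ℤ.*-identityˡ (g 1)) (sym (ℤ.*-identityʳ (g 1)))
    ∏-shiftˡ g (suc k) = trans (cong (_* g (suc (suc k))) (∏-shiftˡ g k)) (ℤ.*-assoc (g 1) _ _)

  ∏-pred : ∀ (x : ℕ → ℤ) k → x k * ∏ (λ j → x (j ∸ 1)) k ≡ x 0 * ∏ x k
  ∏-pred x zero    = refl
  ∏-pred x (suc k) = begin
    x (suc k) * (∏ (λ j → x (j ∸ 1)) k * x k)   ≡⟨ rearrange (x (suc k)) _ (x k) ⟩
    (x k * ∏ (λ j → x (j ∸ 1)) k) * x (suc k)   ≡⟨ cong (_* x (suc k)) (∏-pred x k) ⟩
    (x 0 * ∏ x k) * x (suc k)                    ≡⟨ ℤ.*-assoc (x 0) (∏ x k) (x (suc k)) ⟩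
    x 0 * ∏ x (suc k)                            ∎
    where
    open ≡-Reasoning
    rearrange : ∀ (a b c : ℤ) → a * (b * c) ≡ (c * b) * a
    rearrange = solve-∀

  ∸-swap : ∀ a x y → a ∸ x ∸ y ≡ a ∸ y ∸ x
  ∸-swap a x y = trans (ℕ.∸-+-assoc a x y) (trans (cong (a ∸_) (ℕ.+-comm x y)) (sym (ℕ.∸-+-assoc a y x)))

  triangle-swap : ∀ (ν μ : ℕ → ℕ) K →
    sumFT 1 K (λ i → sumFT i K (λ j → ν i ℕ.* μ j)) ≡ sumFT 1 K (λ j → sumFT 1 j ν ℕ.* μ j)
  triangle-swap ν μ zero    = refl
  triangle-swap ν μ (suc K) = begin
    sumFT 1 (suc K) (λ i → sumFT i (suc K) (λ j → ν i ℕ.* μ j))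
      ≡⟨ sumFT-cong 1 (suc K) (λ i _ i≤ → sumFT-snoc i K (λ j → ν i ℕ.* μ j) i≤) ⟩
    sumFT 1 (suc K) (λ i → sumFT i K (λ j → ν i ℕ.* μ j) ℕ.+ ν i ℕ.* μ (suc K))
      ≡⟨ sumFT-+ 1 (suc K) (λ i → sumFT i K (λ j → ν i ℕ.* μ j)) (λ i → ν i ℕ.* μ (suc K)) ⟩
    sumFT 1 (suc K) (λ i → sumFT i K (λ j → ν i ℕ.* μ j)) ℕ.+ sumFT 1 (suc K) (λ i → ν i ℕ.* μ (suc K))
      ≡⟨ cong₂ ℕ._+_ old-rows (∑ℕ-*ʳ (range 1 (suc K)) (μ (suc K)) ν) ⟩
    sumFT 1 K (λ j → sumFT 1 j ν ℕ.* μ j) ℕ.+ sumFT 1 (suc K) ν ℕ.* μ (suc K)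
      ≡⟨ sym (sumFT-snoc 1 K _ (s≤s z≤n)) ⟩
    sumFT 1 (suc K) (λ j → sumFT 1 j ν ℕ.* μ j) ∎
    where
    open ≡-Reasoning
    old-rows : sumFT 1 (suc K) (λ i → sumFT i K (λ j → ν i ℕ.* μ j)) ≡ sumFT 1 K (λ j → sumFT 1 j ν ℕ.* μ j)
    old-rows = begin
      sumFT 1 (suc K) (λ i → sumFT i K (λ j → ν i ℕ.* μ j))
        ≡⟨ sumFT-snoc 1 K _ (s≤s z≤n) ⟩
      sumFT 1 K (λ i → sumFT i K (λ j → ν i ℕ.* μ j)) ℕ.+ sumFT (suc K) K (λ j → ν (suc K) ℕ.* μ j)
        ≡⟨ cong (sumFT 1 K (λ i → sumFT i K (λ j → ν i ℕ.* μ j)) ℕ.+_) (sumFT-empty (suc K) K _ ℕ.≤-refl) ⟩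
      sumFT 1 K (λ i → sumFT i K (λ j → ν i ℕ.* μ j)) ℕ.+ 0
        ≡⟨ trans (ℕ.+-identityʳ _) (triangle-swap ν μ K) ⟩
      sumFT 1 K (λ j → sumFT 1 j ν ℕ.* μ j) ∎

  module BlockStaircase (q : ℤ) (μ ν : ℕ → ℕ) (k a : ℕ)
    (fits : ∀ i → 1 ≤ i → i ≤ k → sumFT 1 i ν ℕ.+ sumFT i k μ ≤ a)
    (H : ℕ → ℕ)
    (H-block : ∀ j u → suc j ≤ k → u < μ (suc j) → H (sumFT 1 j μ ℕ.+ u) ≡ sumFT 1 (suc j) ν) where

    budget : ℕ → ℕ
    budget j = a ∸ sumFT (suc j) k μ

    height : ℕ → ℕ
    height j = sumFT 1 j ν

    denominator numerator : ℕ → ℤ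
    denominator j = poch q q (budget j ∸ μ j ∸ height j)
    numerator   j = poch q q (budget j ∸ height j)

    exponent : ℕ → ℕ
    exponent j = sumFT 1 j (λ i → height i ℕ.* μ i)

    private
      suffix-cons : ∀ j → suc j ≤ k → sumFT (suc j) k μ ≡ μ (suc j) ℕ.+ sumFT (suc (suc j)) k μ
      suffix-cons j j<k = sumFT-cons (suc j) k μ j<k

    budget-∸-block : ∀ j → suc j ≤ k → budget (suc j) ∸ μ (suc j) ≡ budget j
    budget-∸-block j j<k = trans (ℕ.∸-+-assoc a (sumFT (suc (suc j)) k μ) (μ (suc j)))
      (cong (a ∸_) (trans (ℕ.+-comm _ (μ (suc j))) (sym (suffix-cons j j<k))))

    block-fits-budget : ∀ j → suc j ≤ k → μ (suc j) ℕ.+ height (suc j) ≤ budget (suc j)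
    block-fits-budget j j<k = ℕ.m+n≤o⇒m≤o∸n (t ℕ.+ h) (ℕ.≤-trans (ℕ.≤-reflexive regroup) (fits (suc j) (s≤s z≤n) j<k))
      where
      t = μ (suc j)
      h = height (suc j)
      rest = sumFT (suc (suc j)) k μ
      regroup : t ℕ.+ h ℕ.+ rest ≡ h ℕ.+ sumFT (suc j) k μ
      regroup = trans (cong (ℕ._+ rest) (ℕ.+-comm t h)) (trans (ℕ.+-assoc h t rest) (cong (h ℕ.+_) (sym (suffix-cons j j<k))))

    staircaseProduct-blocks : ∀ j → j ≤ k →
      staircaseProduct q H (sumFT 1 j μ) (budget j) * ∏ denominator j
        ≡ q ^ exponent j * (poch q q (budget 0) * ∏ numerator j)
    staircaseProduct-blocks zero _ = sym (ℤ.*-identityˡ _)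
    staircaseProduct-blocks (suc j) j<k = begin
      staircaseProduct q H (sumFT 1 (suc j) μ) b * ∏ denominator (suc j)
        ≡⟨ cong (λ Y → staircaseProduct q H Y b * ∏ denominator (suc j)) (sumFT-snoc 1 j μ (s≤s z≤n)) ⟩
      staircaseProduct q H (X ℕ.+ t) b * ∏ denominator (suc j)
        ≡⟨ cong (_* ∏ denominator (suc j)) (staircaseProduct-block q H X h t b (λ u u<t → H-block j u j<k u<t)) ⟩
      blockProduct q h t b * staircaseProduct q H X (b ∸ t) * ∏ denominator (suc j)
        ≡⟨ cong (λ e → blockProduct q h t b * staircaseProduct q H X e * ∏ denominator (suc j)) (budget-∸-block j j<k) ⟩
      blockProduct q h t b * staircaseProduct q H X (budget j) * (∏ denominator j * denominator (suc j))
        ≡⟨ regroup₁ (blockProduct q h t b) (staircaseProduct q H X (budget j)) (∏ denominator j) (denominator (suc j)) ⟩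
      (blockProduct q h t b * denominator (suc j)) * (staircaseProduct q H X (budget j) * ∏ denominator j)
        ≡⟨ cong₂ _*_ (blockProduct-poch q h t b (block-fits-budget j j<k)) (staircaseProduct-blocks j (ℕ.≤-trans (ℕ.n≤1+n j) j<k)) ⟩
      (q ^ (h ℕ.* t) * numerator (suc j)) * (q ^ exponent j * (poch q q (budget 0) * ∏ numerator j))
        ≡⟨ regroup₂ (q ^ (h ℕ.* t)) (numerator (suc j)) (q ^ exponent j) (poch q q (budget 0)) (∏ numerator j) ⟩
      (q ^ exponent j * q ^ (h ℕ.* t)) * (poch q q (budget 0) * ∏ numerator (suc j))
        ≡⟨ cong (_* (poch q q (budget 0) * ∏ numerator (suc j))) (sym (ℤ.^-distribˡ-+-* q (exponent j) (h ℕ.* t))) ⟩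
      q ^ (exponent j ℕ.+ h ℕ.* t) * (poch q q (budget 0) * ∏ numerator (suc j))
        ≡⟨ cong (λ e → q ^ e * (poch q q (budget 0) * ∏ numerator (suc j))) (sym (sumFT-snoc 1 j _ (s≤s z≤n))) ⟩
      q ^ exponent (suc j) * (poch q q (budget 0) * ∏ numerator (suc j)) ∎
      where
      open ≡-Reasoning
      X = sumFT 1 j μ
      t = μ (suc j)
      h = height (suc j)
      b = budget (suc j)
      regroup₁ : ∀ (x y z w : ℤ) → (x * y) * (z * w) ≡ (x * w) * (y * z)
      regroup₁ = solve-∀
      regroup₂ : ∀ (c u d p pu : ℤ) → (c * u) * (d * (p * pu)) ≡ (d * c) * (p * (pu * u))
      regroup₂ = solve-∀

    staircaseProduct-all-blocks :
      staircaseProduct q H (sumFT 1 k μ) a * ∏ denominator k ≡ q ^ exponent k * (poch q q (budget 0) * ∏ numerator k)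
    staircaseProduct-all-blocks = trans
      (cong (λ b → staircaseProduct q H (sumFT 1 k μ) (a ∸ b) * ∏ denominator k) (sym (sumFT-empty (suc k) k μ ℕ.≤-refl)))
      (staircaseProduct-blocks k ℕ.≤-refl)

    denominators : prodℤ (map (λ i → poch q q (a ∸ sumFT 1 (k ∸ i ℕ.+ 1) ν ∸ sumFT (k ∸ i ℕ.+ 1) k μ)) (range 1 k))
                     ≡ ∏ denominator k
    denominators = begin
      prodℤ (map (λ i → F (k ∸ i ℕ.+ 1)) (range 1 k))  ≡⟨ prodℤ-range-1 _ k ⟩
      ∏ (λ i → F (k ∸ i ℕ.+ 1)) k                     ≡⟨ ∏-reverse F k ⟩
      ∏ F k                                           ≡⟨ ∏-cong k (λ j _ j≤k → cong (poch q q) (sym (budget-order j j≤k))) ⟩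
      ∏ denominator k                                 ∎
      where
      open ≡-Reasoning
      F : ℕ → ℤ
      F j = poch q q (a ∸ height j ∸ sumFT j k μ)
      budget-order : ∀ j → j ≤ k → budget j ∸ μ j ∸ height j ≡ a ∸ height j ∸ sumFT j k μ
      budget-order j j≤k = trans (cong (_∸ height j) (trans (ℕ.∸-+-assoc a (sumFT (suc j) k μ) (μ j))
                                   (cong (a ∸_) (trans (ℕ.+-comm _ (μ j)) (sym (sumFT-cons j k μ j≤k))))))
                                 (∸-swap a (sumFT j k μ) (height j))

    numerators : prodℤ (map (λ i → poch q q (a ∸ sumFT 1 (k ∸ i) ν ∸ sumFT (k ∸ i ℕ.+ 1) k μ)) (range 0 k))
                   ≡ poch q q (budget 0) * ∏ numerator k
    numerators = begin
      prodℤ (map (λ i → F (k ∸ i)) (range 0 k))        ≡⟨ prodℤ-range-0 (λ i → F (k ∸ i)) k ⟩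
      F k * ∏ (λ i → F (k ∸ i)) k                      ≡⟨ cong (F k *_) (∏-cong k (λ i _ _ → cong F (sym (ℕ.m+n∸n≡m (k ∸ i) 1)))) ⟩
      F k * ∏ (λ i → F (k ∸ i ℕ.+ 1 ∸ 1)) k            ≡⟨ cong (F k *_) (∏-reverse (λ j → F (j ∸ 1)) k) ⟩
      F k * ∏ (λ j → F (j ∸ 1)) k                      ≡⟨ ∏-pred F k ⟩
      F 0 * ∏ F k                                      ≡⟨ cong (F 0 *_) (∏-cong k (λ j _ _ → cong (poch q q) (budget-order j))) ⟩
      poch q q (budget 0) * ∏ numerator k              ∎
      where
      open ≡-Reasoning
      F : ℕ → ℤ
      F j = poch q q (a ∸ height j ∸ sumFT (j ℕ.+ 1) k μ)
      budget-order : ∀ j → a ∸ height j ∸ sumFT (j ℕ.+ 1) k μ ≡ budget j ∸ height j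
      budget-order j = trans (∸-swap a (height j) (sumFT (j ℕ.+ 1) k μ)) (cong (λ z → a ∸ sumFT z k μ ∸ height j) (ℕ.+-comm j 1))

module BlockTriangular where

  open import Data.Bool using (Bool; true; if_then_else_)
  open import Data.Fin using (Fin; toℕ)
  import Data.Fin.Properties as Fin
  open import Data.List using (filter)
  open import Data.Nat as ℕ using (ℕ; _≤_; _<_; _<?_; _∸_; _+_; _*_)
  import Data.Nat.Properties as ℕ
  open import Data.Integer using (+_) renaming (_*_ to _*ℤ_; _^_ to _^ℤ_)
  open import Function.Bundles using (Equivalence; _⇔_)
  open import Relation.Binary.PropositionalEquality using (_≡_; refl; trans; cong; subst; module ≡-Reasoning)
  open import Relation.Nullary using (yes; no; does)
  open import Relation.Nullary.Decidable using (⌊_⌋; isYes≗does; dec-true)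
  open import Defs
  open Counting
  open Linear
  open QPochhammer
  open StaircaseMatrices
  open Ranks
  open BlockIndices
  open BlockProducts

  module BlockUT {c ℓ} (F : FiniteField c ℓ) {k} (n m : Fin k → ℕ) (1≤k : 1 ≤ k) where

    open FF F
    open LinearAlgebra F using (isZero⇒≈0; ≈0⇒isZero)
    open Staircase F

    private
      μ ν : ℕ → ℕ
      μ = at m
      ν = at n
      Nₜ Mₜ : ℕ
      Nₜ = sumFT 1 k ν
      Mₜ = sumFT 1 k μ

    heights : ℕ → ℕ
    heights s = sumFT 1 (block μ k s) ν

    blockUT≡staircase? : ∀ (A : Matrix Nₜ Mₜ) → isBlockUT n m A ≡ does (staircase? heights A)
    blockUT≡staircase? A = reflects-does (staircase? heights A) blockUT⇒staircase staircase⇒blockUT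
      where
      below⇔ : ∀ i j → (block μ k (toℕ j) < block ν k (toℕ i)) ⇔ (heights (toℕ j) ≤ toℕ i)
      below⇔ i j = block<block⇔ μ ν k (toℕ j) (toℕ i) 1≤k (Fin.toℕ<n j)

      blockUT⇒staircase : isBlockUT n m A ≡ true → Staircase heights A
      blockUT⇒staircase ut i j H≤i = isZero⇒≈0 (subst (λ t → (if t then isZero (A i j) else true) ≡ true) below entry)
        where
        entry = allB-true⇒ _ (allFin Mₜ) (allB-true⇒ _ (allFin Nₜ) ut (allFin-complete i)) (allFin-complete j)
        below? = block μ k (toℕ j) <? block ν k (toℕ i)
        below : ⌊ below? ⌋ ≡ true
        below = trans (isYes≗does below?) (dec-true below? (Equivalence.from (below⇔ i j) H≤i))

      staircase⇒blockUT : Staircase heights A → isBlockUT n m A ≡ true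
      staircase⇒blockUT st = allB-true⇐ _ (allFin Nₜ) λ {i} _ → allB-true⇐ _ (allFin Mₜ) λ {j} _ → cell i j
        where
        cell : ∀ i j → (if ⌊ block μ k (toℕ j) <? block ν k (toℕ i) ⌋ then isZero (A i j) else true) ≡ true
        cell i j with block μ k (toℕ j) <? block ν k (toℕ i)
        ... | yes below = ≈0⇒isZero (st i j (Equivalence.to (below⇔ i j) below))
        ... | no  _     = refl

    module Budget (a : ℕ) (fits : ∀ i → 1 ≤ i → i ≤ k → sumFT 1 i ν + sumFT i k μ ≤ a) where

      fkq≡staircaseProduct : fkq a n m ≡ staircaseProduct q heights Mₜ a
      fkq≡staircaseProduct = begin
        fkq a n m
          ≡⟨ ∑ℤ-filter (isBlockUT n m) (allMatrices Nₜ Mₜ) _ ⟩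
        ∑ℤ (allMatrices Nₜ Mₜ) (λ A → if isBlockUT n m A then poch q q (a ∸ rank A) else + 0)
          ≡⟨ ∑ℤ-cong (allMatrices Nₜ Mₜ) (λ A → cong (λ t → if t then poch q q (a ∸ rank A) else + 0) (blockUT≡staircase? A)) ⟩
        ∑ℤ (allMatrices Nₜ Mₜ) (weight Nₜ heights a)
          ≡⟨ staircase-sum Nₜ Mₜ heights a
               (λ s s<M → prefix-mono ν (block≤k μ k s 1≤k s<M))
               (λ s s′ s≤s′ _ → prefix-mono ν (block-mono μ k s≤s′))
               (ℕ.m+n≤o⇒n≤o (sumFT 1 1 ν) (fits 1 ℕ.≤-refl 1≤k)) ⟩
        staircaseProduct q heights Mₜ a ∎
        where open ≡-Reasoning

      open BlockStaircase q μ ν k a fits heights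
             (λ j u j<k u<μ → cong (λ b → sumFT 1 b ν) (block-of-offset μ k j u j<k u<μ)) public

-- Opened only here, after the development: these names would clash with the field operations above.
open import Defs
open import Level using (Level)
open import Data.Nat using (ℕ; _≤_; _∸_; _+_; _*_)
open import Data.Fin using (Fin)
open import Data.List using (map)
open import Data.Integer using (+_) renaming (_*_ to _*ℤ_; _^_ to _^ℤ_)
open import Relation.Binary.PropositionalEquality using (_≡_; trans; sym; cong; cong₂)
open BlockTriangular
open BlockProducts using (triangle-swap)

proposition2p6 : ∀ {c ℓ : Level} (F : FiniteField c ℓ) (k : ℕ) → 1 ≤ k →
    (n m : Fin k → ℕ) (a : ℕ) →
    (∀ i → 1 ≤ i → i ≤ k → sumFT 1 i (at n) + sumFT i k (at m) ≤ a) →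
    FF.fkq F a n m
      *ℤ prodℤ (map (λ i → poch (FF.q F) (FF.q F)
                 (a ∸ sumFT 1 (k ∸ i + 1) (at n) ∸ sumFT (k ∸ i + 1) k (at m))) (range 1 k))
    ≡ (FF.q F ^ℤ sumFT 1 k (λ i → sumFT i k (λ j → at n i * at m j)))
      *ℤ prodℤ (map (λ i → poch (FF.q F) (FF.q F)
                 (a ∸ sumFT 1 (k ∸ i) (at n) ∸ sumFT (k ∸ i + 1) k (at m))) (range 0 k))
proposition2p6 F k 1≤k n m a fits =
  trans (cong₂ _*ℤ_ fkq≡staircaseProduct denominators)
  (trans staircaseProduct-all-blocks
         (cong₂ _*ℤ_ (cong (q ^ℤ_) (sym (triangle-swap (at n) (at m) k))) (sym numerators)))
  where
  open FF F using (q)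
  open BlockUT.Budget F n m 1≤k a fits
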